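{- Let $n\ge 4$ be an integer and $A_{1,n}$ the fan graph. Then every automorphism of $F_2(A_{1,n})$ is induced by an automorphism of $A_{1,n}$, i.e. $\mathrm{Aut}(F_2(A_{1,n}))=\mathrm{Aut}(A_{1,n})$ (a group of order $2$).
   Context: The fan graph $A_{1,n}$ is the join $K_1+P_n$: vertex set $\{v,u_1,\dots,u_n\}$, with $u_i\sim u_{i+1}$ for $1\le i\le n-1$ and $v$ adjacent to every $u_i$, and no other edges. For a graph $\Gamma$, the $2$-token graph $F_2(\Gamma)$ has as vertices all $2$-element subsets of $V(\Gamma)$, two being adjacent iff their symmetric difference is an edge of $\Gamma$. An automorphism $\theta$ of $\Gamma$ induces the automorphism $\{a,b\}\mapsto\{\theta(a),\theta(b)\}$ of $F_2(\Gamma)$; $\mathrm{Aut}(F_2(\Gamma))=\mathrm{Aut}(\Gamma)$ means every automorphism of $F_2(\Gamma)$ is of this form. -}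

module Defs where

open import Data.Nat using (ℕ; zero; suc)
open import Data.Fin using (Fin; zero; suc; toℕ; _<_)
open import Data.Product using (Σ; _×_; _,_; ∃; proj₁; proj₂)
open import Data.Sum using (_⊎_)
open import Relation.Nullary using (¬_)
open import Relation.Binary.PropositionalEquality using (_≡_)
open import Function.Bundles using (_↔_; Inverse; _⇔_)
open import Level using (0ℓ)

record Graph : Set₁ where
  field
    V : Set
    E : V → V → Set

open Graph public

record Aut (Γ : Graph) : Set where
  field
    perm : V Γ ↔ V Γ
    pres : ∀ x y → E Γ x y ⇔ E Γ (Inverse.to perm x) (Inverse.to perm y)

open Aut public

-- Fan graph A_{1,n} on Fin (suc n): vertex 0 is v, vertex (suc i) is u_{i+1}.
-- u_i ~ u_{i+1}, and v adjacent to every u_i.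
data FanAdj {n : ℕ} : Fin (suc n) → Fin (suc n) → Set where
  hub-l : (i : Fin n) → FanAdj zero (suc i)
  hub-r : (i : Fin n) → FanAdj (suc i) zero
  path-l : (i j : Fin n) → suc (toℕ i) ≡ toℕ j → FanAdj (suc i) (suc j)
  path-r : (i j : Fin n) → toℕ i ≡ suc (toℕ j) → FanAdj (suc i) (suc j)

Fan : ℕ → Graph
Fan n = record { V = Fin (suc n) ; E = FanAdj {n} }

-- 2-element subsets of Fin m, represented as pairs (a , b) with a < b.
Pair2 : ℕ → Set
Pair2 m = Σ (Fin m × Fin m) λ p → proj₁ p < proj₂ p

_∈₂_ : {m : ℕ} → Fin m → Pair2 m → Set
z ∈₂ ((a , b) , _) = (z ≡ a) ⊎ (z ≡ b)

_xor_ : Set → Set → Set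
P xor Q = (P × ¬ Q) ⊎ (Q × ¬ P)

-- 2-token graph of a graph with vertex set Fin m: A ~ B iff their symmetric
-- difference is {x , y} for an edge x ~ y.
F2 : (m : ℕ) → (Fin m → Fin m → Set) → Graph
F2 m Adj = record
  { V = Pair2 m
  ; E = λ A B → Σ (Fin m × Fin m) λ xy →
          Adj (proj₁ xy) (proj₂ xy) ×
          (∀ z → ((z ∈₂ A) xor (z ∈₂ B)) ⇔ ((z ≡ proj₁ xy) ⊎ (z ≡ proj₂ xy)))
  }

F2Fan : ℕ → Graph
F2Fan n = F2 (suc n) (FanAdj {n})

InducedBy : (n : ℕ) → Aut (F2Fan n) → Aut (Fan n) → Set
InducedBy n φ θ = ∀ (A : Pair2 (suc n)) z →
  (z ∈₂ Inverse.to (perm φ) A) ⇔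
  ((z ≡ Inverse.to (perm θ) (proj₁ (proj₁ A))) ⊎ (z ≡ Inverse.to (perm θ) (proj₂ (proj₁ A))))

_≗ᴬ_ : {Γ : Graph} → Aut Γ → Aut Γ → Set
_≗ᴬ_ {Γ} σ τ = ∀ x → Inverse.to (perm σ) x ≡ Inverse.to (perm τ) x

HasOrderTwo : Graph → Set
HasOrderTwo Γ = Σ (Aut Γ × Aut Γ) λ στ →
  (¬ (proj₁ στ ≗ᴬ proj₂ στ)) ×
  ((θ : Aut Γ) → (θ ≗ᴬ proj₁ στ) ⊎ (θ ≗ᴬ proj₂ στ))

module Submission where

-- Two distinct vertices of F₂(A_{1,n}) have three common neighbours only if they are the diagonals
-- {v,u_{k+2}} and {u_{k+1},u_{k+3}} of a 4-cycle of the fan, and no two pairs {u_{k+1},u_{k+3}} are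
-- adjacent. Hence an automorphism of F₂ permutes the pairs {v,u_i}, 2 ≤ i ≤ n−1, preserving the path
-- they form, so it acts on them as i ↦ i or i ↦ n+1−i; composing with the automorphism induced by the
-- reflection u_i ↦ u_{n+1−i} we may assume that it fixes them all. A degree count then fixes {v,u₁},
-- by symmetry also {v,u_n}, and {u_a,u_b} is fixed as the only common neighbour of {v,u_a} and
-- {v,u_b} not of the form {v,u}. Automorphisms of the fan itself are handled the same way: v is its
-- only vertex of degree at least 4, and the rim is a path.

open import Defs
open import Data.Nat using (ℕ; zero; suc; pred; _+_; _∸_; _≤_; _<_; z≤n; s≤s; z<s; _≟_; _<?_; _≤?_; _<ᵇ_; _≤ᵇ_)
open import Data.Nat.Properties
  using (≤-refl; ≤-trans; ≤-pred; <⇒≤; <-irrefl; <-asym; <-irrelevant; <-≤-trans; ≤∧≢⇒<; ≮⇒≥;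
         n≤1+n; n<1+n; m<n⇒m<1+n; m≤n+m; n≤0⇒n≡0; <ᵇ⇒<; ≤ᵇ⇒≤; m≢1+n+m;
         +-suc; +-assoc; +-comm; +-identityʳ; +-cancelˡ-≡; +-cancelʳ-≡;
         m+n∸n≡m; m∸n≤m; m∸n+n≡m; ∸-monoˡ-≤)
open import Data.Fin using (Fin; zero; suc; toℕ; fromℕ<; opposite)
open import Data.Fin.Properties
  using (toℕ-injective; toℕ<n; toℕ-fromℕ<; opposite-prop; opposite-involutive)
  renaming (_≟_ to _≟ᶠ_; _<?_ to _<?ᶠ_)
open import Data.Nat.DivMod using (_mod_; m%n<n; m<n⇒m%n≡m)
open import Data.Bool using (T)
open import Data.Product using (Σ; _×_; _,_; proj₁; proj₂)
open import Data.Sum using (_⊎_; inj₁; inj₂; [_,_]; swap) renaming (map to ⊎-map)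
open import Data.Unit using (⊤; tt)
open import Data.Empty using (⊥; ⊥-elim)
open import Relation.Nullary using (¬_; yes; no)
open import Relation.Binary.PropositionalEquality
  using (_≡_; _≢_; refl; sym; trans; cong; cong₂; subst; subst₂; module ≡-Reasoning)
open import Function using (id; _∘_)
open import Function.Bundles using (_⇔_; mk⇔; Equivalence; Inverse; mk↔ₛ′)
open import Function.Properties.Equivalence using () renaming (refl to ⇔-refl; sym to ⇔-sym; trans to ⇔-trans)
open import Function.Related.TypeIsomorphisms using (¬-cong-⇔)
open import Data.Sum.Function.Propositional using (_⊎-⇔_)
open import Data.Product.Function.NonDependent.Propositional using (_×-⇔_)

no-three-in-pair : {A : Set} {x y u₁ u₂ u₃ : A} →
  u₁ ≡ x ⊎ u₁ ≡ y → u₂ ≡ x ⊎ u₂ ≡ y → u₃ ≡ x ⊎ u₃ ≡ y →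
  u₁ ≢ u₂ → u₁ ≢ u₃ → u₂ ≢ u₃ → ⊥
no-three-in-pair (inj₁ refl) (inj₁ refl) _ u₁≢u₂ _ _ = u₁≢u₂ refl
no-three-in-pair (inj₂ refl) (inj₂ refl) _ u₁≢u₂ _ _ = u₁≢u₂ refl
no-three-in-pair (inj₁ refl) _ (inj₁ refl) _ u₁≢u₃ _ = u₁≢u₃ refl
no-three-in-pair (inj₂ refl) _ (inj₂ refl) _ u₁≢u₃ _ = u₁≢u₃ refl
no-three-in-pair _ (inj₁ refl) (inj₁ refl) _ _ u₂≢u₃ = u₂≢u₃ refl
no-three-in-pair _ (inj₂ refl) (inj₂ refl) _ _ u₂≢u₃ = u₂≢u₃ refl

no-four-in-triple : {A : Set} {x y z u₁ u₂ u₃ u₄ : A} →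
  u₁ ≡ x ⊎ u₁ ≡ y ⊎ u₁ ≡ z → u₂ ≡ x ⊎ u₂ ≡ y ⊎ u₂ ≡ z →
  u₃ ≡ x ⊎ u₃ ≡ y ⊎ u₃ ≡ z → u₄ ≡ x ⊎ u₄ ≡ y ⊎ u₄ ≡ z →
  u₁ ≢ u₂ → u₁ ≢ u₃ → u₁ ≢ u₄ → u₂ ≢ u₃ → u₂ ≢ u₄ → u₃ ≢ u₄ → ⊥
no-four-in-triple (inj₁ refl) h₂ h₃ h₄ d₁₂ d₁₃ d₁₄ d₂₃ d₂₄ d₃₄ =
  no-three-in-pair (drop h₂ d₁₂) (drop h₃ d₁₃) (drop h₄ d₁₄) d₂₃ d₂₄ d₃₄
  where
  drop : ∀ {u v w t} → u ≡ t ⊎ u ≡ v ⊎ u ≡ w → t ≢ u → u ≡ v ⊎ u ≡ w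
  drop (inj₁ refl) d = ⊥-elim (d refl)
  drop (inj₂ h) _ = h
no-four-in-triple (inj₂ (inj₁ refl)) h₂ h₃ h₄ d₁₂ d₁₃ d₁₄ d₂₃ d₂₄ d₃₄ =
  no-three-in-pair (drop h₂ d₁₂) (drop h₃ d₁₃) (drop h₄ d₁₄) d₂₃ d₂₄ d₃₄
  where
  drop : ∀ {u v w t} → u ≡ v ⊎ u ≡ t ⊎ u ≡ w → t ≢ u → u ≡ v ⊎ u ≡ w
  drop (inj₁ h) _ = inj₁ h
  drop (inj₂ (inj₁ refl)) d = ⊥-elim (d refl)
  drop (inj₂ (inj₂ h)) _ = inj₂ h
no-four-in-triple (inj₂ (inj₂ refl)) h₂ h₃ h₄ d₁₂ d₁₃ d₁₄ d₂₃ d₂₄ d₃₄ =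
  no-three-in-pair (drop h₂ d₁₂) (drop h₃ d₁₃) (drop h₄ d₁₄) d₂₃ d₂₄ d₃₄
  where
  drop : ∀ {u v w t} → u ≡ v ⊎ u ≡ w ⊎ u ≡ t → t ≢ u → u ≡ v ⊎ u ≡ w
  drop (inj₁ h) _ = inj₁ h
  drop (inj₂ (inj₁ h)) _ = inj₂ h
  drop (inj₂ (inj₂ refl)) d = ⊥-elim (d refl)

2+n≢n : ∀ n → suc (suc n) ≢ n
2+n≢n n e = m≢1+n+m n {1} (sym e)

xor-of-pairs : {A : Set} {PA PB : A → Set} {s x y : A} → s ≢ x → s ≢ y → x ≢ y →
  (∀ z → PA z → z ≡ s ⊎ z ≡ x) → (∀ z → z ≡ s ⊎ z ≡ x → PA z) →
  (∀ z → PB z → z ≡ s ⊎ z ≡ y) → (∀ z → z ≡ s ⊎ z ≡ y → PB z) →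
  ∀ z → (PA z xor PB z) ⇔ (z ≡ x ⊎ z ≡ y)
xor-of-pairs {PA = PA} {PB} {s} {x} {y} s≢x s≢y x≢y A⊆ ⊆A B⊆ ⊆B z = mk⇔ to from
  where
  to : PA z xor PB z → z ≡ x ⊎ z ≡ y
  to (inj₁ (pa , ¬pb)) with A⊆ z pa
  ... | inj₁ refl = ⊥-elim (¬pb (⊆B z (inj₁ refl)))
  ... | inj₂ e = inj₁ e
  to (inj₂ (pb , ¬pa)) with B⊆ z pb
  ... | inj₁ refl = ⊥-elim (¬pa (⊆A z (inj₁ refl)))
  ... | inj₂ e = inj₂ e
  from : z ≡ x ⊎ z ≡ y → PA z xor PB z
  from (inj₁ refl) = inj₁ (⊆A z (inj₂ refl) , λ pb → [ (λ e → s≢x (sym e)) , x≢y ] (B⊆ z pb))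
  from (inj₂ refl) = inj₂ (⊆B z (inj₂ refl) , λ pa → [ (λ e → s≢y (sym e)) , (λ e → x≢y (sym e)) ] (A⊆ z pa))

xor-cong : {P P′ Q Q′ : Set} → P ⇔ P′ → Q ⇔ Q′ → (P xor Q) ⇔ (P′ xor Q′)
xor-cong P⇔P′ Q⇔Q′ = (P⇔P′ ×-⇔ ¬-cong-⇔ Q⇔Q′) ⊎-⇔ (Q⇔Q′ ×-⇔ ¬-cong-⇔ P⇔P′)

-- Rigidity of paths

Consecutive : ℕ → ℕ → Set
Consecutive x y = suc x ≡ y ⊎ suc y ≡ x

_∈[_,_] : ℕ → ℕ → ℕ → Set
i ∈[ lo , hi ] = lo ≤ i × i ≤ hi

module IntervalRigidity (lo hi : ℕ) (lo<hi : lo < hi) (f g : ℕ → ℕ)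
  (f-range : ∀ {i} → i ∈[ lo , hi ] → f i ∈[ lo , hi ])
  (g-range : ∀ {i} → i ∈[ lo , hi ] → g i ∈[ lo , hi ])
  (g∘f : ∀ {i} → i ∈[ lo , hi ] → g (f i) ≡ i)
  (f∘g : ∀ {i} → i ∈[ lo , hi ] → f (g i) ≡ i)
  (f-consecutive : ∀ {i} → lo ≤ i → suc i ≤ hi → Consecutive (f i) (f (suc i)))
  (g-consecutive : ∀ {i} → lo ≤ i → suc i ≤ hi → Consecutive (g i) (g (suc i)))
  where

  private
    lo≤hi : lo ≤ hi
    lo≤hi = ≤-trans (n≤1+n lo) lo<hi

    lo∈ : lo ∈[ lo , hi ]
    lo∈ = ≤-refl , lo≤hi

    lo≤k+lo : ∀ k → lo ≤ k + lo
    lo≤k+lo k = m≤n+m lo k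

    f-injective : ∀ {i j} → i ∈[ lo , hi ] → j ∈[ lo , hi ] → f i ≡ f j → i ≡ j
    f-injective i∈ j∈ e = trans (sym (g∘f i∈)) (trans (cong g e) (g∘f j∈))

    successor-of-lo : ∀ {x y} → x ≡ lo → lo ≤ y → Consecutive x y ⊎ Consecutive y x → y ≡ suc lo
    successor-of-lo refl lo≤y (inj₁ (inj₁ e)) = sym e
    successor-of-lo refl lo≤y (inj₁ (inj₂ refl)) = ⊥-elim (<-irrefl refl lo≤y)
    successor-of-lo refl lo≤y (inj₂ (inj₁ refl)) = ⊥-elim (<-irrefl refl lo≤y)
    successor-of-lo refl lo≤y (inj₂ (inj₂ e)) = sym e

    predecessor-of-hi : ∀ {x y} → x ≡ hi → y ≤ hi → Consecutive x y ⊎ Consecutive y x → suc y ≡ hi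
    predecessor-of-hi refl y≤hi (inj₁ (inj₁ refl)) = ⊥-elim (<-irrefl refl y≤hi)
    predecessor-of-hi refl y≤hi (inj₁ (inj₂ e)) = e
    predecessor-of-hi refl y≤hi (inj₂ (inj₁ e)) = e
    predecessor-of-hi refl y≤hi (inj₂ (inj₂ refl)) = ⊥-elim (<-irrefl refl y≤hi)

  -- An interior value c = f lo would have two neighbours c ± 1, both sent by g next to g c = lo.
  f-lo-is-endpoint : f lo ≡ lo ⊎ f lo ≡ hi
  f-lo-is-endpoint with f lo ≟ lo | f lo ≟ hi
  ... | yes e | _ = inj₁ e
  ... | no _ | yes e = inj₂ e
  ... | no ≢lo | no ≢hi = ⊥-elim (interior (f lo) refl (f-range lo∈) ≢lo ≢hi)
    where
    interior : ∀ c → f lo ≡ c → c ∈[ lo , hi ] → c ≢ lo → c ≢ hi → ⊥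
    interior zero _ (lo≤0 , _) c≢lo _ = c≢lo (sym (n≤0⇒n≡0 lo≤0))
    interior (suc c) e (lo≤1+c , 1+c≤hi) c≢lo c≢hi =
      2+n≢n c (trans (sym (f∘g c+2∈)) (trans (cong f (trans g[c+2] (sym g[c]))) (f∘g c∈)))
      where
      lo≤c : lo ≤ c
      lo≤c = ≤-pred (≤∧≢⇒< lo≤1+c (λ q → c≢lo (sym q)))
      c+2≤hi : suc (suc c) ≤ hi
      c+2≤hi = ≤∧≢⇒< 1+c≤hi c≢hi
      c∈ : c ∈[ lo , hi ]
      c∈ = lo≤c , <⇒≤ 1+c≤hi
      c+2∈ : suc (suc c) ∈[ lo , hi ]
      c+2∈ = <⇒≤ (<⇒≤ (s≤s (s≤s lo≤c))) , c+2≤hi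
      g[c+1] : g (suc c) ≡ lo
      g[c+1] = trans (cong g (sym e)) (g∘f lo∈)
      g[c] : g c ≡ suc lo
      g[c] = successor-of-lo g[c+1] (proj₁ (g-range c∈)) (inj₂ (g-consecutive lo≤c 1+c≤hi))
      g[c+2] : g (suc (suc c)) ≡ suc lo
      g[c+2] = successor-of-lo g[c+1] (proj₁ (g-range c+2∈)) (inj₁ (g-consecutive lo≤1+c c+2≤hi))

  fixes-from-lo : f lo ≡ lo → ∀ k → k + lo ≤ hi → f (k + lo) ≡ k + lo
  fixes-from-lo f[lo] zero _ = f[lo]
  fixes-from-lo f[lo] (suc zero) 1+lo≤hi =
    successor-of-lo f[lo] (proj₁ (f-range (lo≤k+lo 1 , 1+lo≤hi))) (inj₁ (f-consecutive ≤-refl 1+lo≤hi))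
  fixes-from-lo f[lo] (suc (suc k)) k+2+lo≤hi =
    step (fixes-from-lo f[lo] (suc k) (<⇒≤ k+2+lo≤hi)) (fixes-from-lo f[lo] k (<⇒≤ (<⇒≤ k+2+lo≤hi)))
    where
    step : f (suc k + lo) ≡ suc k + lo → f (k + lo) ≡ k + lo → f (suc (suc k) + lo) ≡ suc (suc k) + lo
    step f[k+1] f[k] with f-consecutive (lo≤k+lo (suc k)) k+2+lo≤hi
    ... | inj₁ e = trans (sym e) (cong suc f[k+1])
    ... | inj₂ e = ⊥-elim (2+n≢n (k + lo) (f-injective (lo≤k+lo (suc (suc k)) , k+2+lo≤hi)
                                                     (lo≤k+lo k , <⇒≤ (<⇒≤ k+2+lo≤hi))
                                                     (trans (cong pred (trans e f[k+1])) (sym f[k]))))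

  reflects-from-lo : f lo ≡ hi → ∀ k → k + lo ≤ hi → f (k + lo) + k ≡ hi
  reflects-from-lo f[lo] zero _ = trans (+-identityʳ _) f[lo]
  reflects-from-lo f[lo] (suc zero) 1+lo≤hi =
    trans (+-comm _ 1) (predecessor-of-hi f[lo] (proj₂ (f-range (lo≤k+lo 1 , 1+lo≤hi)))
                                          (inj₁ (f-consecutive ≤-refl 1+lo≤hi)))
  reflects-from-lo f[lo] (suc (suc k)) k+2+lo≤hi =
    step (reflects-from-lo f[lo] (suc k) (<⇒≤ k+2+lo≤hi)) (reflects-from-lo f[lo] k (<⇒≤ (<⇒≤ k+2+lo≤hi)))
    where
    f₀ = f (k + lo)
    f₁ = f (suc k + lo)
    f₂ = f (suc (suc k) + lo)
    step : f₁ + suc k ≡ hi → f₀ + k ≡ hi → f₂ + suc (suc k) ≡ hi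
    step f₁+k+1 f₀+k with f-consecutive (lo≤k+lo (suc k)) k+2+lo≤hi
    ... | inj₂ e = trans (+-suc f₂ (suc k)) (trans (cong (_+ suc k) e) f₁+k+1)
    ... | inj₁ e = ⊥-elim (2+n≢n (k + lo) (f-injective (lo≤k+lo (suc (suc k)) , k+2+lo≤hi)
                                                     (lo≤k+lo k , <⇒≤ (<⇒≤ k+2+lo≤hi))
                                                     (+-cancelʳ-≡ k f₂ f₀ f₂+k≡f₀+k)))
      where
      f₂+k≡f₀+k : f₂ + k ≡ f₀ + k
      f₂+k≡f₀+k = trans (cong (_+ k) (sym e)) (trans (sym (+-suc f₁ k)) (trans f₁+k+1 (sym f₀+k)))

  identity-or-reflection : (∀ {i} → i ∈[ lo , hi ] → f i ≡ i) ⊎ (∀ {i} → i ∈[ lo , hi ] → f i + i ≡ lo + hi)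
  identity-or-reflection with f-lo-is-endpoint
  ... | inj₁ f[lo] = inj₁ λ {i} (lo≤i , i≤hi) →
    subst (λ t → f t ≡ t) (m∸n+n≡m lo≤i) (fixes-from-lo f[lo] (i ∸ lo) (subst (_≤ hi) (sym (m∸n+n≡m lo≤i)) i≤hi))
  ... | inj₂ f[lo] = inj₂ λ {i} (lo≤i , i≤hi) →
    subst (λ t → f t + t ≡ lo + hi) (m∸n+n≡m lo≤i)
      (shift (i ∸ lo) (reflects-from-lo f[lo] (i ∸ lo) (subst (_≤ hi) (sym (m∸n+n≡m lo≤i)) i≤hi)))
    where
    shift : ∀ k → f (k + lo) + k ≡ hi → f (k + lo) + (k + lo) ≡ lo + hi
    shift k e = trans (sym (+-assoc (f (k + lo)) k lo)) (trans (cong (_+ lo) e) (+-comm hi lo))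

-- Automorphisms induced on 2-subsets

FinGraph : (m : ℕ) → (Fin m → Fin m → Set) → Graph
FinGraph m Adj = record { V = Fin m ; E = Adj }

module _ {m : ℕ} where

  pair₂ : (a b : Fin m) → a ≢ b → Pair2 m
  pair₂ a b a≢b with a <?ᶠ b
  ... | yes a<b = (a , b) , a<b
  ... | no a≮b = (b , a) , ≤∧≢⇒< (≮⇒≥ a≮b) (λ e → a≢b (sym (toℕ-injective e)))

  ∈-pair₂ : ∀ {a b} (a≢b : a ≢ b) z → z ∈₂ pair₂ a b a≢b ⇔ (z ≡ a ⊎ z ≡ b)
  ∈-pair₂ {a} {b} _ _ with a <?ᶠ b
  ... | yes _ = ⇔-refl
  ... | no _ = mk⇔ swap swap

  ⊆⇒≡ : {X Y : Pair2 m} → (∀ z → z ∈₂ X → z ∈₂ Y) → X ≡ Y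
  ⊆⇒≡ {(a , b) , a<b} {(c , d) , c<d} X⊆Y with X⊆Y a (inj₁ refl) | X⊆Y b (inj₂ refl)
  ... | inj₁ refl | inj₁ refl = ⊥-elim (<-irrefl refl a<b)
  ... | inj₁ refl | inj₂ refl = cong ((a , b) ,_) (<-irrelevant a<b c<d)
  ... | inj₂ refl | inj₁ refl = ⊥-elim (<-asym a<b c<d)
  ... | inj₂ refl | inj₂ refl = ⊥-elim (<-irrefl refl a<b)

module Image {m : ℕ} (f g : Fin m → Fin m) (g∘f : ∀ x → g (f x) ≡ x) (f∘g : ∀ x → f (g x) ≡ x) where

  private
    g≡⇔≡f : ∀ {z x} → g z ≡ x ⇔ z ≡ f x
    g≡⇔≡f {z} = mk⇔ (λ { refl → sym (f∘g z) }) (λ { refl → g∘f _ })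

  image₂ : Pair2 m → Pair2 m
  image₂ ((a , b) , a<b) = pair₂ (f a) (f b) λ e →
    <-irrefl (cong toℕ (trans (sym (g∘f a)) (trans (cong g e) (g∘f b)))) a<b

  ∈-image₂ : ∀ X z → z ∈₂ image₂ X ⇔ (z ≡ f (proj₁ (proj₁ X)) ⊎ z ≡ f (proj₂ (proj₁ X)))
  ∈-image₂ ((a , b) , _) = ∈-pair₂ _

  ∈-image₂⇔ : ∀ X z → z ∈₂ image₂ X ⇔ g z ∈₂ X
  ∈-image₂⇔ X z = ⇔-trans (∈-image₂ X z) (⇔-sym (g≡⇔≡f ⊎-⇔ g≡⇔≡f))

  image₂-E : ∀ {Adj} → (∀ {x y} → Adj x y → Adj (f x) (f y)) →
    ∀ {A B} → E (F2 m Adj) A B → E (F2 m Adj) (image₂ A) (image₂ B)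
  image₂-E f-adj {A} {B} ((x , y) , x~y , symdiff) = (f x , f y) , f-adj x~y , λ z →
    ⇔-trans (xor-cong (∈-image₂⇔ A z) (∈-image₂⇔ B z)) (⇔-trans (symdiff (g z)) (g≡⇔≡f ⊎-⇔ g≡⇔≡f))

image₂-inverse : ∀ {m} (f g : Fin m → Fin m) (g∘f : ∀ x → g (f x) ≡ x) (f∘g : ∀ x → f (g x) ≡ x) X →
  Image.image₂ g f f∘g g∘f (Image.image₂ f g g∘f f∘g X) ≡ X
image₂-inverse f g g∘f f∘g X = ⊆⇒≡ λ z z∈ →
  subst (_∈₂ X) (g∘f z) (Equivalence.to (F.∈-image₂⇔ X (f z)) (Equivalence.to (G.∈-image₂⇔ (F.image₂ X) z) z∈))
  where
  module F = Image f g g∘f f∘g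
  module G = Image g f f∘g g∘f

module _ {Γ : Graph} (θ : Aut Γ) where

  open Inverse (perm θ) using (to; from; strictlyInverseˡ; strictlyInverseʳ)

  Aut-injective : ∀ {x y} → to x ≡ to y → x ≡ y
  Aut-injective {x} {y} e = trans (sym (strictlyInverseʳ x)) (trans (cong from e) (strictlyInverseʳ y))

  Aut⁻¹-injective : ∀ {x y} → from x ≡ from y → x ≡ y
  Aut⁻¹-injective {x} {y} e = trans (sym (strictlyInverseˡ x)) (trans (cong to e) (strictlyInverseˡ y))

  Aut-E : ∀ {x y} → E Γ x y → E Γ (to x) (to y)
  Aut-E {x} {y} = Equivalence.to (pres θ x y)

  Aut⁻¹-E : ∀ {x y} → E Γ x y → E Γ (from x) (from y)
  Aut⁻¹-E {x} {y} h =
    Equivalence.from (pres θ (from x) (from y)) (subst₂ (E Γ) (sym (strictlyInverseˡ x)) (sym (strictlyInverseˡ y)) h)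

liftAut : ∀ {m Adj} → Aut (FinGraph m Adj) → Aut (F2 m Adj)
liftAut {m} {Adj} θ = record
  { perm = mk↔ₛ′ F.image₂ F⁻¹.image₂ (image₂-inverse from to to∘from from∘to) (image₂-inverse to from from∘to to∘from)
  ; pres = λ A B → mk⇔ (F.image₂-E (Aut-E θ) {A} {B})
      (λ h → subst₂ (E (F2 m Adj)) (image₂-inverse to from from∘to to∘from A) (image₂-inverse to from from∘to to∘from B)
                    (F⁻¹.image₂-E (Aut⁻¹-E θ) {F.image₂ A} {F.image₂ B} h))
  }
  where
  to = Inverse.to (perm θ)
  from = Inverse.from (perm θ)
  from∘to = Inverse.strictlyInverseʳ (perm θ)
  to∘from = Inverse.strictlyInverseˡ (perm θ)
  module F = Image to from from∘to to∘from
  module F⁻¹ = Image from to to∘from from∘to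

module _ {m : ℕ} {Adj : Fin m → Fin m → Set} (θ : Aut (FinGraph m Adj)) where

  open Inverse (perm θ) using (to; from; strictlyInverseˡ; strictlyInverseʳ)

  ∈-liftAut : ∀ X z → z ∈₂ Inverse.to (perm (liftAut θ)) X ⇔ (z ≡ to (proj₁ (proj₁ X)) ⊎ z ≡ to (proj₂ (proj₁ X)))
  ∈-liftAut = Image.∈-image₂ to from strictlyInverseʳ strictlyInverseˡ

  ∈-liftAut⇔ : ∀ X z → z ∈₂ Inverse.to (perm (liftAut θ)) X ⇔ from z ∈₂ X
  ∈-liftAut⇔ = Image.∈-image₂⇔ to from strictlyInverseʳ strictlyInverseˡ

idAut : ∀ {Γ} → Aut Γ
idAut = record { perm = mk↔ₛ′ id id (λ _ → refl) (λ _ → refl) ; pres = λ _ _ → ⇔-refl }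

liftAut-id : ∀ {m Adj} X → Inverse.to (perm (liftAut {m} {Adj} idAut)) X ≡ X
liftAut-id {m} {Adj} X = ⊆⇒≡ λ z → Equivalence.to (∈-liftAut⇔ {m} {Adj} idAut X z)

-- The fan and its automorphisms

-- FanAdj read on toℕ-values: 0 is the hub v and i ≥ 1 is u_i.
FanAdjℕ : ℕ → ℕ → Set
FanAdjℕ zero zero = ⊥
FanAdjℕ zero (suc _) = ⊤
FanAdjℕ (suc _) zero = ⊤
FanAdjℕ (suc x) (suc y) = suc x ≡ y ⊎ x ≡ suc y

fanAdjℕ-sym : ∀ x y → FanAdjℕ x y → FanAdjℕ y x
fanAdjℕ-sym zero (suc y) _ = tt
fanAdjℕ-sym (suc x) zero _ = tt
fanAdjℕ-sym (suc x) (suc .(suc x)) (inj₁ refl) = inj₂ refl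
fanAdjℕ-sym (suc .(suc y)) (suc y) (inj₂ refl) = inj₁ refl

fanAdjℕ-irrefl : ∀ x → ¬ FanAdjℕ x x
fanAdjℕ-irrefl zero ()
fanAdjℕ-irrefl (suc x) (inj₁ ())
fanAdjℕ-irrefl (suc x) (inj₂ ())

FanAdj⇒FanAdjℕ : ∀ {n} {x y : Fin (suc n)} → FanAdj x y → FanAdjℕ (toℕ x) (toℕ y)
FanAdj⇒FanAdjℕ (hub-l _) = tt
FanAdj⇒FanAdjℕ (hub-r _) = tt
FanAdj⇒FanAdjℕ (path-l _ _ e) = inj₁ e
FanAdj⇒FanAdjℕ (path-r _ _ e) = inj₂ e

FanAdjℕ⇒FanAdj : ∀ {n} {x y : Fin (suc n)} → FanAdjℕ (toℕ x) (toℕ y) → FanAdj x y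
FanAdjℕ⇒FanAdj {x = zero} {suc j} _ = hub-l j
FanAdjℕ⇒FanAdj {x = suc i} {zero} _ = hub-r i
FanAdjℕ⇒FanAdj {x = suc i} {suc j} (inj₁ e) = path-l i j e
FanAdjℕ⇒FanAdj {x = suc i} {suc j} (inj₂ e) = path-r i j e

fanAdjℕ⇒consecutive : ∀ {a b} → 0 < a → 0 < b → FanAdjℕ a b → Consecutive a b
fanAdjℕ⇒consecutive z<s z<s (inj₁ e) = inj₁ (cong suc e)
fanAdjℕ⇒consecutive z<s z<s (inj₂ e) = inj₂ (cong suc (sym e))

rim-neighbours : ∀ c u → FanAdjℕ (suc c) u → u ≡ 0 ⊎ u ≡ c ⊎ u ≡ suc (suc c)
rim-neighbours c zero _ = inj₁ refl
rim-neighbours c (suc u) (inj₁ e) = inj₂ (inj₂ (cong suc (sym e)))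
rim-neighbours c (suc u) (inj₂ e) = inj₂ (inj₁ (sym e))

opposite-sum : ∀ {n} (i : Fin n) → toℕ (opposite i) + suc (toℕ i) ≡ n
opposite-sum i = trans (cong (_+ suc (toℕ i)) (opposite-prop i)) (m∸n+n≡m (toℕ<n i))

opposite-consecutive : ∀ {n} (i j : Fin n) → suc (toℕ i) ≡ toℕ j → toℕ (opposite i) ≡ suc (toℕ (opposite j))
opposite-consecutive {n} i j e = +-cancelʳ-≡ (suc (toℕ i)) _ _ (begin
  toℕ (opposite i) + suc (toℕ i)       ≡⟨ opposite-sum i ⟩
  n                                    ≡⟨ opposite-sum j ⟨
  toℕ (opposite j) + suc (toℕ j)       ≡⟨ cong (λ t → toℕ (opposite j) + suc t) e ⟨
  toℕ (opposite j) + suc (suc (toℕ i)) ≡⟨ +-suc _ _ ⟩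
  suc (toℕ (opposite j)) + suc (toℕ i) ∎)
  where open ≡-Reasoning

reflect : ∀ {n} → Fin (suc n) → Fin (suc n)
reflect zero = zero
reflect (suc i) = suc (opposite i)

reflect-involutive : ∀ {n} (x : Fin (suc n)) → reflect (reflect x) ≡ x
reflect-involutive zero = refl
reflect-involutive (suc i) = cong suc (opposite-involutive i)

reflect-FanAdj : ∀ {n} {x y : Fin (suc n)} → FanAdj x y → FanAdj (reflect x) (reflect y)
reflect-FanAdj (hub-l i) = hub-l (opposite i)
reflect-FanAdj (hub-r i) = hub-r (opposite i)
reflect-FanAdj (path-l i j e) = path-r (opposite i) (opposite j) (opposite-consecutive i j e)
reflect-FanAdj (path-r i j e) = path-l (opposite i) (opposite j) (sym (opposite-consecutive j i (sym e)))

reflectAut : ∀ {n} → Aut (Fan n)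
reflectAut = record
  { perm = mk↔ₛ′ reflect reflect reflect-involutive reflect-involutive
  ; pres = λ x y → mk⇔ reflect-FanAdj
      (λ h → subst₂ FanAdj (reflect-involutive x) (reflect-involutive y) (reflect-FanAdj h))
  }

InducedBy-liftAut : ∀ {n} (φ : Aut (F2Fan n)) (θ : Aut (Fan n)) →
  (∀ A → Inverse.to (perm φ) A ≡ Inverse.to (perm (liftAut {suc n} {FanAdj} θ)) A) → InducedBy n φ θ
InducedBy-liftAut {n} φ θ φ≗θ A z =
  subst (λ X → z ∈₂ X ⇔ (z ≡ Inverse.to (perm θ) (proj₁ (proj₁ A)) ⊎ z ≡ Inverse.to (perm θ) (proj₂ (proj₁ A))))
        (sym (φ≗θ A)) (∈-liftAut {suc n} {FanAdj} θ A z)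

-- The hub has degree n ≥ 4, every rim vertex degree at most 3.
Aut-fixes-hub : ∀ {m} (θ : Aut (Fan (4 + m))) → Inverse.to (perm θ) zero ≡ zero
Aut-fixes-hub θ with Inverse.to (perm θ) zero in θ[v]
... | zero = refl
... | suc c = ⊥-elim (no-four-in-triple
                        (image-near u₁ (hub-l _)) (image-near u₂ (hub-l _)) (image-near u₃ (hub-l _)) (image-near u₄ (hub-l _))
                        (apart (λ ())) (apart (λ ())) (apart (λ ())) (apart (λ ())) (apart (λ ())) (apart (λ ())))
  where
  u₁ u₂ u₃ u₄ : Fin _
  u₁ = suc zero
  u₂ = suc (suc zero)
  u₃ = suc (suc (suc zero))
  u₄ = suc (suc (suc (suc zero)))
  image-near : ∀ u → FanAdj zero u →
    let t = toℕ (Inverse.to (perm θ) u) in t ≡ 0 ⊎ t ≡ toℕ c ⊎ t ≡ suc (suc (toℕ c))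
  image-near u v~u = rim-neighbours (toℕ c) _
    (subst (λ w → FanAdjℕ (toℕ w) (toℕ (Inverse.to (perm θ) u))) θ[v] (FanAdj⇒FanAdjℕ (Aut-E θ v~u)))
  apart : ∀ {x y} → x ≢ y → toℕ (Inverse.to (perm θ) x) ≢ toℕ (Inverse.to (perm θ) y)
  apart x≢y e = x≢y (Aut-injective θ (toℕ-injective e))

toℕ-mod : ∀ {n i} → i < suc n → toℕ (i mod suc n) ≡ i
toℕ-mod {n} {i} i<1+n = trans (toℕ-fromℕ< (m%n<n i (suc n))) (m<n⇒m%n≡m i<1+n)

mod-toℕ : ∀ {n} (x : Fin (suc n)) → toℕ x mod suc n ≡ x
mod-toℕ x = toℕ-injective (toℕ-mod (toℕ<n x))

rim-map : ∀ {n} → (Fin (suc n) → Fin (suc n)) → ℕ → ℕ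
rim-map {n} h i = toℕ (h (i mod suc n))

module _ {n : ℕ} (h : Fin (suc n) → Fin (suc n)) (h-hub : h zero ≡ zero)
  (h-injective : ∀ {x y} → h x ≡ h y → x ≡ y) (h-FanAdj : ∀ {x y} → FanAdj x y → FanAdj (h x) (h y)) where

  rim-map-range : ∀ {i} → i ∈[ 1 , n ] → rim-map h i ∈[ 1 , n ]
  rim-map-range {i} (1≤i , i≤n) = ≤∧≢⇒< z≤n (λ e → 1≤i≢0 (h-injective (trans (toℕ-injective (sym e)) (sym h-hub)))) ,
                                  ≤-pred (toℕ<n _)
    where
    1≤i≢0 : i mod suc n ≢ zero
    1≤i≢0 e = <-irrefl (sym (trans (sym (toℕ-mod (s≤s i≤n))) (cong toℕ e))) 1≤i

  rim-map-consecutive : ∀ {i} → 1 ≤ i → suc i ≤ n → Consecutive (rim-map h i) (rim-map h (suc i))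
  rim-map-consecutive {i} 1≤i i+1≤n =
    fanAdjℕ⇒consecutive (proj₁ (rim-map-range (1≤i , <⇒≤ i+1≤n))) (proj₁ (rim-map-range (s≤s z≤n , i+1≤n)))
      (FanAdj⇒FanAdjℕ (h-FanAdj (FanAdjℕ⇒FanAdj
        (subst₂ FanAdjℕ (sym (toℕ-mod (s≤s (<⇒≤ i+1≤n)))) (sym (toℕ-mod (s≤s i+1≤n))) (i~i+1 1≤i)))))
    where
    i~i+1 : ∀ {j} → 1 ≤ j → FanAdjℕ j (suc j)
    i~i+1 (s≤s _) = inj₁ refl

rim-map-inverse : ∀ {n} (h k : Fin (suc n) → Fin (suc n)) → (∀ x → k (h x) ≡ x) →
  ∀ {i} → i ∈[ 1 , n ] → rim-map k (rim-map h i) ≡ i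
rim-map-inverse {n} h k k∘h {i} (_ , i≤n) = begin
  toℕ (k (toℕ (h (i mod suc n)) mod suc n)) ≡⟨ cong (toℕ ∘ k) (mod-toℕ _) ⟩
  toℕ (k (h (i mod suc n)))                 ≡⟨ cong toℕ (k∘h _) ⟩
  toℕ (i mod suc n)                         ≡⟨ toℕ-mod (s≤s i≤n) ⟩
  i                                         ∎
  where open ≡-Reasoning

Aut-identity-or-reflect : ∀ {m} (θ : Aut (Fan (4 + m))) → θ ≗ᴬ idAut ⊎ θ ≗ᴬ reflectAut
Aut-identity-or-reflect {m} θ with IntervalRigidity.identity-or-reflection 1 n (s≤s (s≤s z≤n)) (rim-map to) (rim-map from)
    (rim-map-range to θ[v] (Aut-injective θ) (Aut-E θ))
    (rim-map-range from θ⁻¹[v] (Aut⁻¹-injective θ) (Aut⁻¹-E θ))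
    (rim-map-inverse to from strictlyInverseʳ) (rim-map-inverse from to strictlyInverseˡ)
    (rim-map-consecutive to θ[v] (Aut-injective θ) (Aut-E θ))
    (rim-map-consecutive from θ⁻¹[v] (Aut⁻¹-injective θ) (Aut⁻¹-E θ))
  where
  n = 4 + m
  open Inverse (perm θ) using (to; from; strictlyInverseˡ; strictlyInverseʳ)
  θ[v] = Aut-fixes-hub θ
  θ⁻¹[v] : from zero ≡ zero
  θ⁻¹[v] = trans (cong from (sym θ[v])) (strictlyInverseʳ zero)
... | inj₁ identity = inj₁ λ
  { zero → Aut-fixes-hub θ
  ; (suc w) → toℕ-injective
      (trans (cong (toℕ ∘ Inverse.to (perm θ)) (sym (mod-toℕ (suc w)))) (identity (s≤s z≤n , toℕ<n w))) }
... | inj₂ reflection = inj₂ λ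
  { zero → Aut-fixes-hub θ
  ; (suc w) → toℕ-injective (+-cancelʳ-≡ (suc (toℕ w)) _ _ (begin
      toℕ (Inverse.to (perm θ) (suc w)) + suc (toℕ w)
        ≡⟨ cong (λ x → toℕ (Inverse.to (perm θ) x) + suc (toℕ w)) (mod-toℕ (suc w)) ⟨
      rim-map (Inverse.to (perm θ)) (suc (toℕ w)) + suc (toℕ w)
        ≡⟨ reflection (s≤s z≤n , toℕ<n w) ⟩
      suc (4 + m)
        ≡⟨ cong suc (opposite-sum w) ⟨
      suc (toℕ (opposite w)) + suc (toℕ w)
        ∎)) }
  where open ≡-Reasoning

Aut-has-order-two : ∀ {m} → HasOrderTwo (Fan (4 + m))
Aut-has-order-two = (idAut , reflectAut) , (λ id≗ρ → 1≢n (id≗ρ (suc zero))) , Aut-identity-or-reflect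
  where
  1≢n : ∀ {m} → _≢_ {A = Fin (5 + m)} (suc zero) (suc (opposite zero))
  1≢n ()

-- Common neighbours in the 2-token graph

rim-common-neighbour-unique : ∀ a b u v → a ≢ b →
  FanAdjℕ (suc a) (suc u) → FanAdjℕ (suc b) (suc u) →
  FanAdjℕ (suc a) (suc v) → FanAdjℕ (suc b) (suc v) → u ≡ v
rim-common-neighbour-unique a b u v a≢b (inj₁ refl) (inj₁ refl) _ _ = ⊥-elim (a≢b refl)
rim-common-neighbour-unique a b u v a≢b (inj₂ refl) (inj₂ refl) _ _ = ⊥-elim (a≢b refl)
rim-common-neighbour-unique a b u v a≢b _ _ (inj₁ refl) (inj₁ refl) = ⊥-elim (a≢b refl)
rim-common-neighbour-unique a b u v a≢b _ _ (inj₂ refl) (inj₂ refl) = ⊥-elim (a≢b refl)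
rim-common-neighbour-unique a b u v a≢b (inj₁ refl) (inj₂ refl) (inj₁ refl) (inj₂ _) = refl
rim-common-neighbour-unique a b u v a≢b (inj₁ refl) (inj₂ refl) (inj₂ refl) (inj₁ ())
rim-common-neighbour-unique a b u v a≢b (inj₂ refl) (inj₁ refl) (inj₂ refl) (inj₁ _) = refl
rim-common-neighbour-unique a b u v a≢b (inj₂ refl) (inj₁ refl) (inj₁ refl) (inj₂ ())

hub-rim-common-neighbour : ∀ b u → FanAdjℕ 0 u → FanAdjℕ (suc b) u → u ≡ suc (suc b) ⊎ u ≡ b
hub-rim-common-neighbour b (suc u) _ (inj₁ refl) = inj₁ refl
hub-rim-common-neighbour b (suc u) _ (inj₂ refl) = inj₂ refl

no-three-common-neighbours : ∀ a b u₁ u₂ u₃ → a ≢ b → u₁ ≢ u₂ → u₁ ≢ u₃ → u₂ ≢ u₃ →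
  FanAdjℕ a u₁ → FanAdjℕ b u₁ → FanAdjℕ a u₂ → FanAdjℕ b u₂ → FanAdjℕ a u₃ → FanAdjℕ b u₃ → ⊥
no-three-common-neighbours zero zero _ _ _ a≢b _ _ _ _ _ _ _ _ _ = a≢b refl
no-three-common-neighbours zero (suc b) u₁ u₂ u₃ _ d₁₂ d₁₃ d₂₃ x₁ y₁ x₂ y₂ x₃ y₃ =
  no-three-in-pair (hub-rim-common-neighbour b u₁ x₁ y₁) (hub-rim-common-neighbour b u₂ x₂ y₂)
                   (hub-rim-common-neighbour b u₃ x₃ y₃) d₁₂ d₁₃ d₂₃
no-three-common-neighbours (suc a) zero u₁ u₂ u₃ _ d₁₂ d₁₃ d₂₃ x₁ y₁ x₂ y₂ x₃ y₃ =
  no-three-in-pair (hub-rim-common-neighbour a u₁ y₁ x₁) (hub-rim-common-neighbour a u₂ y₂ x₂)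
                   (hub-rim-common-neighbour a u₃ y₃ x₃) d₁₂ d₁₃ d₂₃
no-three-common-neighbours (suc a) (suc b) zero zero _ _ d₁₂ _ _ _ _ _ _ _ _ = d₁₂ refl
no-three-common-neighbours (suc a) (suc b) zero (suc u₂) zero _ _ d₁₃ _ _ _ _ _ _ _ = d₁₃ refl
no-three-common-neighbours (suc a) (suc b) zero (suc u₂) (suc u₃) a≢b _ _ d₂₃ _ _ x₂ y₂ x₃ y₃ =
  d₂₃ (cong suc (rim-common-neighbour-unique a b u₂ u₃ (λ e → a≢b (cong suc e)) x₂ y₂ x₃ y₃))
no-three-common-neighbours (suc a) (suc b) (suc u₁) zero zero _ _ _ d₂₃ _ _ _ _ _ _ = d₂₃ refl
no-three-common-neighbours (suc a) (suc b) (suc u₁) zero (suc u₃) a≢b _ d₁₃ _ x₁ y₁ _ _ x₃ y₃ =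
  d₁₃ (cong suc (rim-common-neighbour-unique a b u₁ u₃ (λ e → a≢b (cong suc e)) x₁ y₁ x₃ y₃))
no-three-common-neighbours (suc a) (suc b) (suc u₁) (suc u₂) _ a≢b d₁₂ _ _ x₁ y₁ x₂ y₂ _ _ =
  d₁₂ (cong suc (rim-common-neighbour-unique a b u₁ u₂ (λ e → a≢b (cong suc e)) x₁ y₁ x₂ y₂))

Pairℕ : Set
Pairℕ = ℕ × ℕ

Ordered : Pairℕ → Set
Ordered (a , b) = a < b

_≈[_,_] : Pairℕ → ℕ → ℕ → Set
X ≈[ p , q ] = X ≡ (p , q) ⊎ X ≡ (q , p)

≈-cases : ∀ {X p q p′ q′} → X ≈[ p , q ] → X ≈[ p′ , q′ ] → (p ≡ p′ × q ≡ q′) ⊎ (p ≡ q′ × q ≡ p′)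
≈-cases (inj₁ refl) (inj₁ refl) = inj₁ (refl , refl)
≈-cases (inj₁ refl) (inj₂ refl) = inj₂ (refl , refl)
≈-cases (inj₂ refl) (inj₁ refl) = inj₂ (refl , refl)
≈-cases (inj₂ refl) (inj₂ refl) = inj₁ (refl , refl)

≈-distinct : ∀ {X p q} → Ordered X → X ≈[ p , q ] → p ≢ q
≈-distinct o (inj₁ refl) refl = <-irrefl refl o
≈-distinct o (inj₂ refl) refl = <-irrefl refl o

≈-unique : ∀ {X Y p q} → Ordered X → Ordered Y → X ≈[ p , q ] → Y ≈[ p , q ] → X ≡ Y
≈-unique _ _ (inj₁ refl) (inj₁ refl) = refl
≈-unique o o′ (inj₁ refl) (inj₂ refl) = ⊥-elim (<-asym o o′)
≈-unique o o′ (inj₂ refl) (inj₁ refl) = ⊥-elim (<-asym o o′)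
≈-unique _ _ (inj₂ refl) (inj₂ refl) = refl

≈-ordered : ∀ {X p q} → Ordered X → X ≈[ p , q ] → p < q → X ≡ (p , q)
≈-ordered _ (inj₁ e) _ = e
≈-ordered o (inj₂ refl) p<q = ⊥-elim (<-asym o p<q)

TokenAdj : Pairℕ → Pairℕ → Set
TokenAdj (a , b) (c , d) =
  (a ≡ c × FanAdjℕ b d) ⊎ (a ≡ d × FanAdjℕ b c) ⊎ (b ≡ c × FanAdjℕ a d) ⊎ (b ≡ d × FanAdjℕ a c)

tokenAdj-view : ∀ C A → TokenAdj C A →
  Σ ℕ λ t → Σ ℕ λ u → Σ ℕ λ u′ → C ≈[ t , u ] × A ≈[ t , u′ ] × FanAdjℕ u u′
tokenAdj-view (c₁ , c₂) (.c₁ , a₂) (inj₁ (refl , f)) = c₁ , c₂ , a₂ , inj₁ refl , inj₁ refl , f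
tokenAdj-view (c₁ , c₂) (a₁ , .c₁) (inj₂ (inj₁ (refl , f))) = c₁ , c₂ , a₁ , inj₁ refl , inj₂ refl , f
tokenAdj-view (c₁ , c₂) (.c₂ , a₂) (inj₂ (inj₂ (inj₁ (refl , f)))) = c₂ , c₁ , a₂ , inj₂ refl , inj₁ refl , f
tokenAdj-view (c₁ , c₂) (a₁ , .c₂) (inj₂ (inj₂ (inj₂ (refl , f)))) = c₂ , c₁ , a₁ , inj₂ refl , inj₂ refl , f

SharedNeighbour : Pairℕ → ℕ → ℕ → ℕ → Set
SharedNeighbour C s a b =
  (Σ ℕ λ u → C ≈[ s , u ] × FanAdjℕ a u × FanAdjℕ b u) ⊎ (C ≈[ a , b ] × FanAdjℕ s a × FanAdjℕ s b)

common-neighbour-shared : ∀ {A B C s a b} → Ordered A → Ordered B → Ordered C →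
  A ≈[ s , a ] → B ≈[ s , b ] → a ≢ b → TokenAdj C A → TokenAdj C B → SharedNeighbour C s a b
common-neighbour-shared {A} {B} {C} {a = a} {b} oA oB oC A≈ B≈ a≢b C~A C~B
  with tokenAdj-view C A C~A | tokenAdj-view C B C~B
... | t , u , u′ , C≈ , A≈′ , f | t′ , w , w′ , C≈′ , B≈′ , g with ≈-cases A≈′ A≈ | ≈-cases B≈′ B≈
... | inj₁ (refl , refl) | inj₁ (refl , refl) with ≈-cases C≈′ C≈
...   | inj₁ (_ , refl) = inj₁ (u , C≈ , fanAdjℕ-sym u a f , fanAdjℕ-sym w b g)
...   | inj₂ (refl , refl) = ⊥-elim (≈-distinct oC C≈ refl)
common-neighbour-shared oA oB oC A≈ B≈ a≢b C~A C~B
  | t , u , u′ , C≈ , A≈′ , f | t′ , w , w′ , C≈′ , B≈′ , g | inj₁ (refl , refl) | inj₂ (refl , refl)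
  with ≈-cases C≈′ C≈
...   | inj₁ (refl , _) = ⊥-elim (≈-distinct oB B≈ refl)
...   | inj₂ (refl , refl) = ⊥-elim (fanAdjℕ-irrefl w g)
common-neighbour-shared oA oB oC A≈ B≈ a≢b C~A C~B
  | t , u , u′ , C≈ , A≈′ , f | t′ , w , w′ , C≈′ , B≈′ , g | inj₂ (refl , refl) | inj₁ (refl , refl)
  with ≈-cases C≈′ C≈
...   | inj₁ (refl , _) = ⊥-elim (≈-distinct oA A≈ refl)
...   | inj₂ (refl , refl) = ⊥-elim (fanAdjℕ-irrefl u f)
common-neighbour-shared {s = s} oA oB oC A≈ B≈ a≢b C~A C~B
  | t , u , u′ , C≈ , A≈′ , f | t′ , w , w′ , C≈′ , B≈′ , g | inj₂ (refl , refl) | inj₂ (refl , refl)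
  with ≈-cases C≈′ C≈
...   | inj₁ (refl , _) = ⊥-elim (a≢b refl)
...   | inj₂ (refl , refl) = inj₂ (C≈ , fanAdjℕ-sym w s g , fanAdjℕ-sym u s f)

no-three-shared-neighbours : ∀ {C₁ C₂ C₃ s a b} → Ordered C₁ → Ordered C₂ → Ordered C₃ → a ≢ b →
  C₁ ≢ C₂ → C₁ ≢ C₃ → C₂ ≢ C₃ →
  SharedNeighbour C₁ s a b → SharedNeighbour C₂ s a b → SharedNeighbour C₃ s a b → ⊥
no-three-shared-neighbours o₁ o₂ _ _ d₁₂ _ _ (inj₂ (x , _)) (inj₂ (y , _)) _ = d₁₂ (≈-unique o₁ o₂ x y)
no-three-shared-neighbours o₁ _ o₃ _ _ d₁₃ _ (inj₂ (x , _)) _ (inj₂ (y , _)) = d₁₃ (≈-unique o₁ o₃ x y)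
no-three-shared-neighbours _ o₂ o₃ _ _ _ d₂₃ _ (inj₂ (x , _)) (inj₂ (y , _)) = d₂₃ (≈-unique o₂ o₃ x y)
no-three-shared-neighbours {a = a} {b} o₁ o₂ o₃ a≢b d₁₂ d₁₃ d₂₃
  (inj₁ (u₁ , x₁ , f₁ , g₁)) (inj₁ (u₂ , x₂ , f₂ , g₂)) (inj₁ (u₃ , x₃ , f₃ , g₃)) =
  no-three-common-neighbours a b u₁ u₂ u₃ a≢b
    (λ { refl → d₁₂ (≈-unique o₁ o₂ x₁ x₂) }) (λ { refl → d₁₃ (≈-unique o₁ o₃ x₁ x₃) })
    (λ { refl → d₂₃ (≈-unique o₂ o₃ x₂ x₃) }) f₁ g₁ f₂ g₂ f₃ g₃
no-three-shared-neighbours {s = s} {a} {b} o₁ o₂ o₃ a≢b d₁₂ d₁₃ d₂₃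
  (inj₂ (_ , f₁ , g₁)) (inj₁ (u₂ , x₂ , f₂ , g₂)) (inj₁ (u₃ , x₃ , f₃ , g₃)) =
  no-three-common-neighbours a b s u₂ u₃ a≢b (≈-distinct o₂ x₂) (≈-distinct o₃ x₃)
    (λ { refl → d₂₃ (≈-unique o₂ o₃ x₂ x₃) }) (fanAdjℕ-sym s a f₁) (fanAdjℕ-sym s b g₁) f₂ g₂ f₃ g₃
no-three-shared-neighbours {s = s} {a} {b} o₁ o₂ o₃ a≢b d₁₂ d₁₃ d₂₃
  (inj₁ (u₁ , x₁ , f₁ , g₁)) (inj₂ (_ , f₂ , g₂)) (inj₁ (u₃ , x₃ , f₃ , g₃)) =
  no-three-common-neighbours a b s u₁ u₃ a≢b (≈-distinct o₁ x₁) (≈-distinct o₃ x₃)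
    (λ { refl → d₁₃ (≈-unique o₁ o₃ x₁ x₃) }) (fanAdjℕ-sym s a f₂) (fanAdjℕ-sym s b g₂) f₁ g₁ f₃ g₃
no-three-shared-neighbours {s = s} {a} {b} o₁ o₂ o₃ a≢b d₁₂ d₁₃ d₂₃
  (inj₁ (u₁ , x₁ , f₁ , g₁)) (inj₁ (u₂ , x₂ , f₂ , g₂)) (inj₂ (_ , f₃ , g₃)) =
  no-three-common-neighbours a b s u₁ u₂ a≢b (≈-distinct o₁ x₁) (≈-distinct o₂ x₂)
    (λ { refl → d₁₂ (≈-unique o₁ o₂ x₁ x₂) }) (fanAdjℕ-sym s a f₃) (fanAdjℕ-sym s b g₃) f₁ g₁ f₂ g₂

DisjointNeighbour : Pairℕ → ℕ → ℕ → ℕ → ℕ → Set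
DisjointNeighbour C a₁ a₂ b₁ b₂ =
    ((C ≈[ a₁ , b₁ ] ⊎ C ≈[ a₂ , b₂ ]) × FanAdjℕ a₁ b₂ × FanAdjℕ a₂ b₁)
  ⊎ ((C ≈[ a₁ , b₂ ] ⊎ C ≈[ a₂ , b₁ ]) × FanAdjℕ a₁ b₁ × FanAdjℕ a₂ b₂)

common-neighbour-disjoint : ∀ {C a₁ a₂ b₁ b₂} → a₁ ≢ b₁ → a₁ ≢ b₂ → a₂ ≢ b₁ → a₂ ≢ b₂ →
  TokenAdj C (a₁ , a₂) → TokenAdj C (b₁ , b₂) → DisjointNeighbour C a₁ a₂ b₁ b₂
common-neighbour-disjoint {C} {a₁} {a₂} {b₁} {b₂} d₁₁ d₁₂ d₂₁ d₂₂ C~A C~B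
  with tokenAdj-view C _ C~A | tokenAdj-view C _ C~B
... | t , u , u′ , C≈ , A≈ , f | t′ , w , w′ , C≈′ , B≈ , g with ≈-cases C≈ C≈′
...   | inj₁ (refl , refl) = ⊥-elim (shares A≈ B≈)
  where
  shares : (a₁ , a₂) ≈[ t , u′ ] → (b₁ , b₂) ≈[ t , w′ ] → ⊥
  shares (inj₁ refl) (inj₁ refl) = d₁₁ refl
  shares (inj₁ refl) (inj₂ refl) = d₁₂ refl
  shares (inj₂ refl) (inj₁ refl) = d₂₁ refl
  shares (inj₂ refl) (inj₂ refl) = d₂₂ refl
...   | inj₂ (refl , refl) with A≈ | B≈
...     | inj₁ refl | inj₁ refl = inj₁ (inj₁ C≈ , g , fanAdjℕ-sym _ _ f)
...     | inj₁ refl | inj₂ refl = inj₂ (inj₁ C≈ , g , fanAdjℕ-sym _ _ f)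
...     | inj₂ refl | inj₁ refl = inj₂ (inj₂ C≈ , fanAdjℕ-sym _ _ f , g)
...     | inj₂ refl | inj₂ refl = inj₁ (inj₂ C≈ , fanAdjℕ-sym _ _ f , g)

no-three-in-two-pairs : ∀ {C₁ C₂ C₃ p q p′ q′} → Ordered C₁ → Ordered C₂ → Ordered C₃ →
  (C₁ ≈[ p , q ] ⊎ C₁ ≈[ p′ , q′ ]) → (C₂ ≈[ p , q ] ⊎ C₂ ≈[ p′ , q′ ]) →
  (C₃ ≈[ p , q ] ⊎ C₃ ≈[ p′ , q′ ]) →
  C₁ ≢ C₂ → C₁ ≢ C₃ → C₂ ≢ C₃ → ⊥
no-three-in-two-pairs o₁ o₂ o₃ (inj₁ x) (inj₁ y) _ d₁₂ _ _ = d₁₂ (≈-unique o₁ o₂ x y)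
no-three-in-two-pairs o₁ o₂ o₃ (inj₂ x) (inj₂ y) _ d₁₂ _ _ = d₁₂ (≈-unique o₁ o₂ x y)
no-three-in-two-pairs o₁ o₂ o₃ (inj₁ x) _ (inj₁ y) _ d₁₃ _ = d₁₃ (≈-unique o₁ o₃ x y)
no-three-in-two-pairs o₁ o₂ o₃ (inj₂ x) _ (inj₂ y) _ d₁₃ _ = d₁₃ (≈-unique o₁ o₃ x y)
no-three-in-two-pairs o₁ o₂ o₃ _ (inj₁ x) (inj₁ y) _ _ d₂₃ = d₂₃ (≈-unique o₂ o₃ x y)
no-three-in-two-pairs o₁ o₂ o₃ _ (inj₂ x) (inj₂ y) _ _ d₂₃ = d₂₃ (≈-unique o₂ o₃ x y)

Biadjacent : ℕ → ℕ → ℕ → ℕ → Set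
Biadjacent a₁ a₂ b₁ b₂ = FanAdjℕ a₁ b₁ × FanAdjℕ a₁ b₂ × FanAdjℕ a₂ b₁ × FanAdjℕ a₂ b₂

three-disjoint-neighbours⇒biadjacent : ∀ {C₁ C₂ C₃ a₁ a₂ b₁ b₂} → Ordered C₁ → Ordered C₂ → Ordered C₃ →
  C₁ ≢ C₂ → C₁ ≢ C₃ → C₂ ≢ C₃ → DisjointNeighbour C₁ a₁ a₂ b₁ b₂ → DisjointNeighbour C₂ a₁ a₂ b₁ b₂ →
  DisjointNeighbour C₃ a₁ a₂ b₁ b₂ → Biadjacent a₁ a₂ b₁ b₂
three-disjoint-neighbours⇒biadjacent o₁ o₂ o₃ d₁₂ d₁₃ d₂₃ (inj₁ (x₁ , _)) (inj₁ (x₂ , _)) (inj₁ (x₃ , _)) =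
  ⊥-elim (no-three-in-two-pairs o₁ o₂ o₃ x₁ x₂ x₃ d₁₂ d₁₃ d₂₃)
three-disjoint-neighbours⇒biadjacent o₁ o₂ o₃ d₁₂ d₁₃ d₂₃ (inj₂ (x₁ , _)) (inj₂ (x₂ , _)) (inj₂ (x₃ , _)) =
  ⊥-elim (no-three-in-two-pairs o₁ o₂ o₃ x₁ x₂ x₃ d₁₂ d₁₃ d₂₃)
three-disjoint-neighbours⇒biadjacent _ _ _ _ _ _ (inj₁ (_ , p , q)) (inj₂ (_ , r , s)) _ = r , p , q , s
three-disjoint-neighbours⇒biadjacent _ _ _ _ _ _ (inj₂ (_ , r , s)) (inj₁ (_ , p , q)) _ = r , p , q , s
three-disjoint-neighbours⇒biadjacent _ _ _ _ _ _ (inj₁ (_ , p , q)) (inj₁ _) (inj₂ (_ , r , s)) = r , p , q , s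
three-disjoint-neighbours⇒biadjacent _ _ _ _ _ _ (inj₂ (_ , r , s)) (inj₂ _) (inj₁ (_ , p , q)) = r , p , q , s

-- {v, u_{k+2}} and {u_{k+1}, u_{k+3}}: the two diagonals of the 4-cycle v u_{k+1} u_{k+2} u_{k+3}.
Straddle : Pairℕ → Pairℕ → Set
Straddle X Y = Σ ℕ λ k → X ≡ (0 , suc (suc k)) × Y ≡ (suc k , suc (suc (suc k)))

biadjacent⇒straddle : ∀ a₁ a₂ b₁ b₂ → a₁ < a₂ → b₁ < b₂ → Biadjacent a₁ a₂ b₁ b₂ →
  Straddle (a₁ , a₂) (b₁ , b₂) ⊎ Straddle (b₁ , b₂) (a₁ , a₂)
biadjacent⇒straddle zero (suc x) zero b₂ _ _ (() , _)
biadjacent⇒straddle zero (suc x) (suc y) (suc z) _ o′ (_ , _ , inj₁ refl , inj₁ refl) = ⊥-elim (<-irrefl refl o′)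
biadjacent⇒straddle zero (suc x) (suc y) (suc z) _ o′ (_ , _ , inj₁ refl , inj₂ refl) = ⊥-elim (<-asym o′ (m<n⇒m<1+n (n<1+n _)))
biadjacent⇒straddle zero (suc x) (suc y) (suc z) _ _ (_ , _ , inj₂ refl , inj₁ refl) = inj₁ (y , refl , refl)
biadjacent⇒straddle zero (suc x) (suc y) (suc z) _ o′ (_ , _ , inj₂ refl , inj₂ refl) = ⊥-elim (<-irrefl refl o′)
biadjacent⇒straddle (suc x) (suc y) zero (suc z) o _ (_ , inj₁ refl , _ , inj₁ refl) = ⊥-elim (<-irrefl refl o)
biadjacent⇒straddle (suc x) (suc y) zero (suc z) _ _ (_ , inj₁ refl , _ , inj₂ refl) = inj₂ (x , refl , refl)
biadjacent⇒straddle (suc x) (suc y) zero (suc z) o _ (_ , inj₂ refl , _ , inj₁ refl) = ⊥-elim (<-asym o (m<n⇒m<1+n (n<1+n _)))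
biadjacent⇒straddle (suc x) (suc y) zero (suc z) o _ (_ , inj₂ refl , _ , inj₂ refl) = ⊥-elim (<-irrefl refl o)
biadjacent⇒straddle (suc x) (suc y) (suc z) (suc w) (s≤s o) (s≤s o′) (f₁₁ , f₁₂ , f₂₁ , f₂₂) =
  ⊥-elim (<-irrefl (rim-common-neighbour-unique x y z w (λ e → <-irrefl e o) f₁₁ f₂₁ f₁₂ f₂₂) o′)

record CommonNeighbours₃ (A B : Pairℕ) : Set where
  field
    C₁ C₂ C₃ : Pairℕ
    ordered₁ : Ordered C₁
    ordered₂ : Ordered C₂
    ordered₃ : Ordered C₃
    C₁≢C₂ : C₁ ≢ C₂
    C₁≢C₃ : C₁ ≢ C₃
    C₂≢C₃ : C₂ ≢ C₃
    C₁~A : TokenAdj C₁ A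
    C₁~B : TokenAdj C₁ B
    C₂~A : TokenAdj C₂ A
    C₂~B : TokenAdj C₂ B
    C₃~A : TokenAdj C₃ A
    C₃~B : TokenAdj C₃ B

overlapping⇒¬CommonNeighbours₃ : ∀ {A B s a b} → Ordered A → Ordered B →
  A ≈[ s , a ] → B ≈[ s , b ] → a ≢ b → ¬ CommonNeighbours₃ A B
overlapping⇒¬CommonNeighbours₃ oA oB A≈ B≈ a≢b cn =
  no-three-shared-neighbours ordered₁ ordered₂ ordered₃ a≢b C₁≢C₂ C₁≢C₃ C₂≢C₃
    (common-neighbour-shared oA oB ordered₁ A≈ B≈ a≢b C₁~A C₁~B)
    (common-neighbour-shared oA oB ordered₂ A≈ B≈ a≢b C₂~A C₂~B)
    (common-neighbour-shared oA oB ordered₃ A≈ B≈ a≢b C₃~A C₃~B)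
  where open CommonNeighbours₃ cn

CommonNeighbours₃⇒straddle : ∀ {A B} → Ordered A → Ordered B → A ≢ B →
  CommonNeighbours₃ A B → Straddle A B ⊎ Straddle B A
CommonNeighbours₃⇒straddle {a₁ , a₂} {b₁ , b₂} oA oB A≢B cn with a₁ ≟ b₁ | a₁ ≟ b₂ | a₂ ≟ b₁ | a₂ ≟ b₂
... | yes refl | _ | _ | yes refl = ⊥-elim (A≢B refl)
... | yes refl | _ | _ | no a₂≢b₂ = ⊥-elim (overlapping⇒¬CommonNeighbours₃ oA oB (inj₁ refl) (inj₁ refl) a₂≢b₂ cn)
... | no _ | yes refl | yes refl | _ = ⊥-elim (<-asym oA oB)
... | no _ | yes refl | no a₂≢b₁ | _ = ⊥-elim (overlapping⇒¬CommonNeighbours₃ oA oB (inj₁ refl) (inj₂ refl) a₂≢b₁ cn)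
... | no _ | no a₁≢b₂ | yes refl | _ = ⊥-elim (overlapping⇒¬CommonNeighbours₃ oA oB (inj₂ refl) (inj₁ refl) a₁≢b₂ cn)
... | no a₁≢b₁ | no _ | no _ | yes refl = ⊥-elim (overlapping⇒¬CommonNeighbours₃ oA oB (inj₂ refl) (inj₂ refl) a₁≢b₁ cn)
... | no d₁₁ | no d₁₂ | no d₂₁ | no d₂₂ =
  biadjacent⇒straddle a₁ a₂ b₁ b₂ oA oB
    (three-disjoint-neighbours⇒biadjacent ordered₁ ordered₂ ordered₃ C₁≢C₂ C₁≢C₃ C₂≢C₃
      (disjoint C₁~A C₁~B) (disjoint C₂~A C₂~B) (disjoint C₃~A C₃~B))
  where
  open CommonNeighbours₃ cn
  disjoint : ∀ {C} → TokenAdj C (a₁ , a₂) → TokenAdj C (b₁ , b₂) → DisjointNeighbour C a₁ a₂ b₁ b₂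
  disjoint = common-neighbour-disjoint d₁₁ d₁₂ d₂₁ d₂₂

common-neighbour-02-03 : ∀ {C} → Ordered C → TokenAdj C (0 , 2) → TokenAdj C (0 , 3) → C ≡ (2 , 3)
common-neighbour-02-03 {C} oC C~02 C~03
  with common-neighbour-shared {A = 0 , 2} {B = 0 , 3} {C} {0} {2} {3} z<s z<s oC (inj₁ refl) (inj₁ refl) (λ ()) C~02 C~03
... | inj₂ (C≈ , _) = ≈-ordered oC C≈ (s≤s (s≤s (s≤s z≤n)))
... | inj₁ (zero , C≈ , _) = ⊥-elim (≈-distinct oC C≈ refl)
... | inj₁ (suc _ , _ , inj₁ refl , inj₁ ())
... | inj₁ (suc _ , _ , inj₁ refl , inj₂ ())
... | inj₁ (suc _ , _ , inj₂ refl , inj₁ ())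
... | inj₁ (suc _ , _ , inj₂ refl , inj₂ ())

common-neighbour-02-13 : ∀ {C} → Ordered C → TokenAdj C (0 , 2) → TokenAdj C (1 , 3) →
  C ≡ (2 , 3) ⊎ C ≡ (1 , 2) ⊎ C ≡ (0 , 3) ⊎ C ≡ (0 , 1)
common-neighbour-02-13 {C} oC C~02 C~13 with common-neighbour-disjoint {C} {0} {2} {1} {3} (λ ()) (λ ()) (λ ()) (λ ()) C~02 C~13
... | inj₁ (inj₁ C≈ , _) = inj₂ (inj₂ (inj₂ (≈-ordered oC C≈ z<s)))
... | inj₁ (inj₂ C≈ , _) = inj₁ (≈-ordered oC C≈ (s≤s (s≤s (s≤s z≤n))))
... | inj₂ (inj₁ C≈ , _) = inj₂ (inj₂ (inj₁ (≈-ordered oC C≈ z<s)))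
... | inj₂ (inj₂ C≈ , _) = inj₂ (inj₁ (≈-ordered oC (swap C≈) (s≤s (s≤s z≤n))))

neighbour-12 : ∀ {C} → Ordered C → TokenAdj C (1 , 2) → C ≡ (0 , 1) ⊎ C ≡ (0 , 2) ⊎ C ≡ (1 , 3)
neighbour-12 {C} oC C~12 with tokenAdj-view C (1 , 2) C~12
... | _ , u , _ , C≈ , inj₁ refl , u~2 with rim-neighbours 1 u (fanAdjℕ-sym u 2 u~2)
...   | inj₁ refl = inj₁ (≈-ordered oC (swap C≈) z<s)
...   | inj₂ (inj₁ refl) = ⊥-elim (≈-distinct oC C≈ refl)
...   | inj₂ (inj₂ refl) = inj₂ (inj₂ (≈-ordered oC C≈ (s≤s (s≤s z≤n))))
neighbour-12 {C} oC C~12 | _ , u , _ , C≈ , inj₂ refl , u~1 with rim-neighbours 0 u (fanAdjℕ-sym u 1 u~1)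
...   | inj₁ refl = inj₂ (inj₁ (≈-ordered oC (swap C≈) z<s))
...   | inj₂ (inj₁ refl) = inj₂ (inj₁ (≈-ordered oC (swap C≈) z<s))
...   | inj₂ (inj₂ refl) = ⊥-elim (≈-distinct oC C≈ refl)

-- Automorphisms of the 2-token graph

module PairCoding (n : ℕ) where

  Pair : Set
  Pair = Pair2 (suc n)

  ⌊_⌋ : Pair → Pairℕ
  ⌊ (a , b) , _ ⌋ = toℕ a , toℕ b

  ⌊⌋-ordered : ∀ X → Ordered ⌊ X ⌋
  ⌊⌋-ordered (_ , a<b) = a<b

  ⌊⌋-bounded : ∀ X → proj₂ ⌊ X ⌋ ≤ n
  ⌊⌋-bounded ((_ , b) , _) = ≤-pred (toℕ<n b)

  ⌊⌋-injective : ∀ {X Y} → ⌊ X ⌋ ≡ ⌊ Y ⌋ → X ≡ Y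
  ⌊⌋-injective {(a , b) , o} {(c , d) , o′} e with toℕ-injective (cong proj₁ e) | toℕ-injective (cong proj₂ e)
  ... | refl | refl = cong ((a , b) ,_) (<-irrelevant o o′)

  _~_ : Pair → Pair → Set
  X ~ Y = TokenAdj ⌊ X ⌋ ⌊ Y ⌋

  pair : (a b : ℕ) → a < b → b ≤ n → Pair
  pair a b a<b b≤n = (fromℕ< a<1+n , fromℕ< (s≤s b≤n)) ,
    subst₂ _<_ (sym (toℕ-fromℕ< a<1+n)) (sym (toℕ-fromℕ< (s≤s b≤n))) a<b
    where
    a<1+n : a < suc n
    a<1+n = m<n⇒m<1+n (<-≤-trans a<b b≤n)

  ⌊pair⌋ : ∀ a b a<b b≤n → ⌊ pair a b a<b b≤n ⌋ ≡ (a , b)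
  ⌊pair⌋ a b a<b b≤n = cong₂ _,_ (toℕ-fromℕ< _) (toℕ-fromℕ< _)

  private
    ends-distinct : ∀ (X : Pair) → proj₁ (proj₁ X) ≢ proj₂ (proj₁ X)
    ends-distinct (_ , a<b) e = <-irrefl (cong toℕ e) a<b

    adjacent-distinct : ∀ {x y : Fin (suc n)} → FanAdjℕ (toℕ x) (toℕ y) → x ≢ y
    adjacent-distinct {x} f refl = fanAdjℕ-irrefl (toℕ x) f

  ~⇒E : ∀ X Y → X ~ Y → E (F2Fan n) X Y
  ~⇒E X@((a₁ , a₂) , _) Y@((b₁ , b₂) , _) (inj₁ (e , f)) with toℕ-injective e
  ... | refl = (a₂ , b₂) , FanAdjℕ⇒FanAdj f ,
    xor-of-pairs (ends-distinct X) (ends-distinct Y) (adjacent-distinct f)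
      (λ _ → id) (λ _ → id) (λ _ → id) (λ _ → id)
  ~⇒E X@((a₁ , a₂) , _) Y@((b₁ , b₂) , _) (inj₂ (inj₁ (e , f))) with toℕ-injective e
  ... | refl = (a₂ , b₁) , FanAdjℕ⇒FanAdj f ,
    xor-of-pairs (ends-distinct X) (λ q → ends-distinct Y (sym q)) (adjacent-distinct f)
      (λ _ → id) (λ _ → id) (λ _ → swap) (λ _ → swap)
  ~⇒E X@((a₁ , a₂) , _) Y@((b₁ , b₂) , _) (inj₂ (inj₂ (inj₁ (e , f)))) with toℕ-injective e
  ... | refl = (a₁ , b₂) , FanAdjℕ⇒FanAdj f ,
    xor-of-pairs (λ q → ends-distinct X (sym q)) (ends-distinct Y) (adjacent-distinct f)
      (λ _ → swap) (λ _ → swap) (λ _ → id) (λ _ → id)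
  ~⇒E X@((a₁ , a₂) , _) Y@((b₁ , b₂) , _) (inj₂ (inj₂ (inj₂ (e , f)))) with toℕ-injective e
  ... | refl = (a₁ , b₁) , FanAdjℕ⇒FanAdj f ,
    xor-of-pairs (λ q → ends-distinct X (sym q)) (λ q → ends-distinct Y (sym q)) (adjacent-distinct f)
      (λ _ → swap) (λ _ → swap) (λ _ → swap) (λ _ → swap)

  E⇒~ : ∀ X Y → E (F2Fan n) X Y → X ~ Y
  E⇒~ X@((a₁ , a₂) , a₁<a₂) Y@((b₁ , b₂) , b₁<b₂) ((x , y) , x~y , symdiff) = cases
    where
    only-in-X : ∀ z → z ∈₂ X → ¬ (z ∈₂ Y) → z ≡ x ⊎ z ≡ y
    only-in-X z p q = Equivalence.to (symdiff z) (inj₁ (p , q))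
    only-in-Y : ∀ z → z ∈₂ Y → ¬ (z ∈₂ X) → z ≡ x ⊎ z ≡ y
    only-in-Y z p q = Equivalence.to (symdiff z) (inj₂ (p , q))
    edge : ∀ {p q} → p ≢ q → p ≡ x ⊎ p ≡ y → q ≡ x ⊎ q ≡ y → FanAdjℕ (toℕ p) (toℕ q)
    edge p≢q (inj₁ refl) (inj₁ refl) = ⊥-elim (p≢q refl)
    edge p≢q (inj₁ refl) (inj₂ refl) = FanAdj⇒FanAdjℕ x~y
    edge p≢q (inj₂ refl) (inj₁ refl) = fanAdjℕ-sym _ _ (FanAdj⇒FanAdjℕ x~y)
    edge p≢q (inj₂ refl) (inj₂ refl) = ⊥-elim (p≢q refl)
    ∉X : ∀ {z} → z ≢ a₁ → z ≢ a₂ → ¬ (z ∈₂ X)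
    ∉X p q = [ p , q ]
    ∉Y : ∀ {z} → z ≢ b₁ → z ≢ b₂ → ¬ (z ∈₂ Y)
    ∉Y p q = [ p , q ]
    a₂≢a₁ : a₂ ≢ a₁
    a₂≢a₁ e = ends-distinct X (sym e)
    b₂≢b₁ : b₂ ≢ b₁
    b₂≢b₁ e = ends-distinct Y (sym e)
    cases : X ~ Y
    cases with a₁ ≟ᶠ b₁ | a₁ ≟ᶠ b₂ | a₂ ≟ᶠ b₁ | a₂ ≟ᶠ b₂
    ... | yes refl | _ | _ | yes refl with Equivalence.from (symdiff x) (inj₁ refl)
    ...   | inj₁ (p , q) = ⊥-elim (q p)
    ...   | inj₂ (p , q) = ⊥-elim (q p)
    cases | yes refl | _ | _ | no d₂₂ =
      inj₁ (refl , edge d₂₂ (only-in-X a₂ (inj₂ refl) (∉Y a₂≢a₁ d₂₂))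
                            (only-in-Y b₂ (inj₂ refl) (∉X b₂≢b₁ (λ e → d₂₂ (sym e)))))
    cases | no _ | yes refl | yes refl | _ = ⊥-elim (<-asym a₁<a₂ b₁<b₂)
    cases | no _ | yes refl | no d₂₁ | _ =
      inj₂ (inj₁ (refl , edge d₂₁ (only-in-X a₂ (inj₂ refl) (∉Y d₂₁ a₂≢a₁))
                                  (only-in-Y b₁ (inj₁ refl) (∉X (ends-distinct Y) (λ e → d₂₁ (sym e))))))
    cases | no d₁₁ | no d₁₂ | yes refl | _ =
      inj₂ (inj₂ (inj₁ (refl , edge d₁₂ (only-in-X a₁ (inj₁ refl) (∉Y d₁₁ d₁₂))
                                        (only-in-Y b₂ (inj₂ refl) (∉X (λ e → d₁₂ (sym e)) b₂≢b₁)))))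
    cases | no d₁₁ | no d₁₂ | no _ | yes refl =
      inj₂ (inj₂ (inj₂ (refl , edge d₁₁ (only-in-X a₁ (inj₁ refl) (∉Y d₁₁ d₁₂))
                                        (only-in-Y b₁ (inj₁ refl) (∉X (λ e → d₁₁ (sym e)) (ends-distinct Y))))))
    cases | no d₁₁ | no d₁₂ | no d₂₁ | no d₂₂ =
      ⊥-elim (no-three-in-pair (only-in-X a₁ (inj₁ refl) (∉Y d₁₁ d₁₂)) (only-in-X a₂ (inj₂ refl) (∉Y d₂₁ d₂₂))
                               (only-in-Y b₁ (inj₁ refl) (∉X (λ e → d₁₁ (sym e)) (λ e → d₂₁ (sym e))))
                               (ends-distinct X) d₁₁ d₂₁)

module TokenGraph (m : ℕ) where

  n : ℕ
  n = suc (suc (suc (suc m)))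

  open PairCoding n public

  record TokenAut : Set where
    field
      to from : Pair → Pair
      to-from : ∀ X → to (from X) ≡ X
      from-to : ∀ X → from (to X) ≡ X
      to-~ : ∀ {X Y} → X ~ Y → to X ~ to Y
      from-~ : ∀ {X Y} → X ~ Y → from X ~ from Y

  open TokenAut public

  fromAut : Aut (F2Fan n) → TokenAut
  fromAut φ = record
    { to = to′
    ; from = from′
    ; to-from = Inverse.strictlyInverseˡ (perm φ)
    ; from-to = Inverse.strictlyInverseʳ (perm φ)
    ; to-~ = λ {X} {Y} X~Y → E⇒~ (to′ X) (to′ Y) (Aut-E φ (~⇒E X Y X~Y))
    ; from-~ = λ {X} {Y} X~Y → E⇒~ (from′ X) (from′ Y) (Aut⁻¹-E φ (~⇒E X Y X~Y))
    }
    where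
    to′ from′ : Pair → Pair
    to′ = Inverse.to (perm φ)
    from′ = Inverse.from (perm φ)

  _⁻¹ : TokenAut → TokenAut
  φ ⁻¹ = record { to = from φ ; from = to φ ; to-from = from-to φ ; from-to = to-from φ
                ; to-~ = from-~ φ ; from-~ = to-~ φ }

  _∘ᵗ_ : TokenAut → TokenAut → TokenAut
  φ ∘ᵗ ψ = record
    { to = λ X → to φ (to ψ X)
    ; from = λ X → from ψ (from φ X)
    ; to-from = λ X → trans (cong (to φ) (to-from ψ (from φ X))) (to-from φ X)
    ; from-to = λ X → trans (cong (from ψ) (from-to φ (to ψ X))) (from-to ψ X)
    ; to-~ = λ X~Y → to-~ φ (to-~ ψ X~Y)
    ; from-~ = λ X~Y → from-~ ψ (from-~ φ X~Y)
    }

  to-injective : (φ : TokenAut) → ∀ {X Y} → to φ X ≡ to φ Y → X ≡ Y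
  to-injective φ {X} {Y} e = trans (sym (from-to φ X)) (trans (cong (from φ) e) (from-to φ Y))

  to-≢ : (φ : TokenAut) → ∀ {X Y} → X ≢ Y → to φ X ≢ to φ Y
  to-≢ φ X≢Y e = X≢Y (to-injective φ e)

  ThreeCommon : Pair → Pair → Set
  ThreeCommon X Y = X ≢ Y × Σ Pair λ C₁ → Σ Pair λ C₂ → Σ Pair λ C₃ →
    C₁ ≢ C₂ × C₁ ≢ C₃ × C₂ ≢ C₃ × C₁ ~ X × C₁ ~ Y × C₂ ~ X × C₂ ~ Y × C₃ ~ X × C₃ ~ Y

  to-ThreeCommon : (φ : TokenAut) → ∀ {X Y} → ThreeCommon X Y → ThreeCommon (to φ X) (to φ Y)
  to-ThreeCommon φ (X≢Y , C₁ , C₂ , C₃ , d₁₂ , d₁₃ , d₂₃ , a₁ , b₁ , a₂ , b₂ , a₃ , b₃) =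
    to-≢ φ X≢Y , to φ C₁ , to φ C₂ , to φ C₃ , to-≢ φ d₁₂ , to-≢ φ d₁₃ , to-≢ φ d₂₃ ,
    to-~ φ a₁ , to-~ φ b₁ , to-~ φ a₂ , to-~ φ b₂ , to-~ φ a₃ , to-~ φ b₃

  ⌊⌋-≢ : ∀ {X Y} → X ≢ Y → ⌊ X ⌋ ≢ ⌊ Y ⌋
  ⌊⌋-≢ X≢Y e = X≢Y (⌊⌋-injective e)

  ThreeCommon⇒straddle : ∀ {X Y} → ThreeCommon X Y → Straddle ⌊ X ⌋ ⌊ Y ⌋ ⊎ Straddle ⌊ Y ⌋ ⌊ X ⌋
  ThreeCommon⇒straddle {X} {Y} (X≢Y , C₁ , C₂ , C₃ , d₁₂ , d₁₃ , d₂₃ , a₁ , b₁ , a₂ , b₂ , a₃ , b₃) =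
    CommonNeighbours₃⇒straddle (⌊⌋-ordered X) (⌊⌋-ordered Y) (⌊⌋-≢ X≢Y) record
      { C₁ = ⌊ C₁ ⌋ ; C₂ = ⌊ C₂ ⌋ ; C₃ = ⌊ C₃ ⌋
      ; ordered₁ = ⌊⌋-ordered C₁ ; ordered₂ = ⌊⌋-ordered C₂ ; ordered₃ = ⌊⌋-ordered C₃
      ; C₁≢C₂ = ⌊⌋-≢ d₁₂ ; C₁≢C₃ = ⌊⌋-≢ d₁₃ ; C₂≢C₃ = ⌊⌋-≢ d₂₃
      ; C₁~A = a₁ ; C₁~B = b₁ ; C₂~A = a₂ ; C₂~B = b₂ ; C₃~A = a₃ ; C₃~B = b₃ }

  -- Rim pairs {u_{k+1}, u_{k+3}} also have a ThreeCommon partner, but no two of them are adjacent.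
  Spoke : Pair → Set
  Spoke X = (Σ Pair λ Y → ThreeCommon X Y) × (Σ Pair λ Y → Σ Pair λ W → ThreeCommon Y W × X ~ Y × X ~ W)

  to-Spoke : (φ : TokenAut) → ∀ {X} → Spoke X → Spoke (to φ X)
  to-Spoke φ ((Y , XY) , (Y′ , W , Y′W , X~Y′ , X~W)) =
    (to φ Y , to-ThreeCommon φ XY) , (to φ Y′ , to φ W , to-ThreeCommon φ Y′W , to-~ φ X~Y′ , to-~ φ X~W)

  rim-straddles-nonadjacent : ∀ k j → ¬ TokenAdj (suc k , suc (suc (suc k))) (suc j , suc (suc (suc j)))
  rim-straddles-nonadjacent k .k (inj₁ (refl , f)) = fanAdjℕ-irrefl _ f
  rim-straddles-nonadjacent .(suc (suc j)) j (inj₂ (inj₁ (refl , inj₁ ())))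
  rim-straddles-nonadjacent .(suc (suc j)) j (inj₂ (inj₁ (refl , inj₂ ())))
  rim-straddles-nonadjacent k .(suc (suc k)) (inj₂ (inj₂ (inj₁ (refl , inj₁ ()))))
  rim-straddles-nonadjacent k .(suc (suc k)) (inj₂ (inj₂ (inj₁ (refl , inj₂ ()))))
  rim-straddles-nonadjacent k .k (inj₂ (inj₂ (inj₂ (refl , f)))) = fanAdjℕ-irrefl _ f

  Spoke⇒hub-pair : ∀ {X} → Spoke X → Σ ℕ λ k → ⌊ X ⌋ ≡ (0 , suc (suc k)) × suc (suc (suc k)) ≤ n
  Spoke⇒hub-pair {X} ((Y , XY) , (Y′ , W , Y′W , X~Y′ , X~W)) with ThreeCommon⇒straddle XY
  ... | inj₁ (k , eX , eY) = k , eX , subst (λ t → proj₂ t ≤ n) eY (⌊⌋-bounded Y)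
  ... | inj₂ (k , eY , eX) with ThreeCommon⇒straddle Y′W
  ...   | inj₁ (j , _ , eW) = ⊥-elim (rim-straddles-nonadjacent k j (subst₂ TokenAdj eX eW X~W))
  ...   | inj₂ (j , _ , eY′) = ⊥-elim (rim-straddles-nonadjacent k j (subst₂ TokenAdj eX eY′ X~Y′))

  Valid : ℕ → ℕ → Set
  Valid a b = a < b × b ≤ n

  valid : ∀ a b → {T (a <ᵇ b)} → {T (b ≤ᵇ n)} → Valid a b
  valid a b {a<ᵇb} {b≤ᵇn} = <ᵇ⇒< a b a<ᵇb , ≤ᵇ⇒≤ b n b≤ᵇn

  abstract
    -- Arguments outside 0 ≤ a < b ≤ n give the junk value {v, u₁}.
    ⟦_,_⟧ : ℕ → ℕ → Pair
    ⟦ a , b ⟧ with a <? b | b ≤? n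
    ... | yes a<b | yes b≤n = pair a b a<b b≤n
    ... | _ | _ = pair 0 1 z<s (s≤s z≤n)

    ⌊⟦⟧⌋ : ∀ {a b} → Valid a b → ⌊ ⟦ a , b ⟧ ⌋ ≡ (a , b)
    ⌊⟦⟧⌋ {a} {b} (a<b , b≤n) with a <? b | b ≤? n
    ... | yes a<b′ | yes b≤n′ = ⌊pair⌋ a b a<b′ b≤n′
    ... | no a≮b | _ = ⊥-elim (a≮b a<b)
    ... | yes _ | no b≰n = ⊥-elim (b≰n b≤n)

  ⌊⌋⇒⟦⟧ : ∀ {X a b} → Valid a b → ⌊ X ⌋ ≡ (a , b) → X ≡ ⟦ a , b ⟧
  ⌊⌋⇒⟦⟧ ab e = ⌊⌋-injective (trans e (sym (⌊⟦⟧⌋ ab)))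

  ⟦⟧-~ : ∀ {a b c d} → Valid a b → Valid c d → TokenAdj (a , b) (c , d) → ⟦ a , b ⟧ ~ ⟦ c , d ⟧
  ⟦⟧-~ ab cd = subst₂ TokenAdj (sym (⌊⟦⟧⌋ ab)) (sym (⌊⟦⟧⌋ cd))

  ⟦⟧-≢ : ∀ {a b c d} → Valid a b → Valid c d → (a , b) ≢ (c , d) → ⟦ a , b ⟧ ≢ ⟦ c , d ⟧
  ⟦⟧-≢ ab cd ne e = ne (trans (sym (⌊⟦⟧⌋ ab)) (trans (cong ⌊_⌋ e) (⌊⟦⟧⌋ cd)))

  hub-rim-ThreeCommon : ∀ k → suc (suc (suc k)) ≤ n →
    ThreeCommon ⟦ 0 , suc (suc k) ⟧ ⟦ suc k , suc (suc (suc k)) ⟧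
  hub-rim-ThreeCommon k k+3≤n =
    ⟦⟧-≢ h₂ r₁₃ (λ ()) ,
    ⟦ 0 , suc k ⟧ , ⟦ 0 , suc (suc (suc k)) ⟧ , ⟦ suc k , suc (suc k) ⟧ ,
    ⟦⟧-≢ h₁ h₃ (λ ()) , ⟦⟧-≢ h₁ r₁₂ (λ ()) , ⟦⟧-≢ h₃ r₁₂ (λ ()) ,
    ⟦⟧-~ h₁ h₂ (inj₁ (refl , inj₁ refl)) , ⟦⟧-~ h₁ r₁₃ (inj₂ (inj₂ (inj₁ (refl , tt)))) ,
    ⟦⟧-~ h₃ h₂ (inj₁ (refl , inj₂ refl)) , ⟦⟧-~ h₃ r₁₃ (inj₂ (inj₂ (inj₂ (refl , tt)))) ,
    ⟦⟧-~ r₁₂ h₂ (inj₂ (inj₂ (inj₂ (refl , tt)))) , ⟦⟧-~ r₁₂ r₁₃ (inj₁ (refl , inj₁ refl))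
    where
    h₁ : Valid 0 (suc k)
    h₁ = z<s , <⇒≤ (<⇒≤ k+3≤n)
    h₂ : Valid 0 (suc (suc k))
    h₂ = z<s , <⇒≤ k+3≤n
    h₃ : Valid 0 (suc (suc (suc k)))
    h₃ = z<s , k+3≤n
    r₁₂ : Valid (suc k) (suc (suc k))
    r₁₂ = n<1+n _ , <⇒≤ k+3≤n
    r₁₃ : Valid (suc k) (suc (suc (suc k)))
    r₁₃ = m<n⇒m<1+n (n<1+n _) , k+3≤n

  hub-adjacent-to-ThreeCommon : ∀ k → suc (suc (suc k)) ≤ n →
    Σ Pair λ Y → Σ Pair λ W → ThreeCommon Y W × ⟦ 0 , suc (suc k) ⟧ ~ Y × ⟦ 0 , suc (suc k) ⟧ ~ W
  hub-adjacent-to-ThreeCommon k k+3≤n with suc (suc (suc (suc k))) ≤? n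
  ... | yes k+4≤n =
    ⟦ 0 , suc (suc (suc k)) ⟧ , ⟦ suc (suc k) , suc (suc (suc (suc k))) ⟧ , hub-rim-ThreeCommon (suc k) k+4≤n ,
    ⟦⟧-~ (z<s , <⇒≤ k+3≤n) (z<s , k+3≤n) (inj₁ (refl , inj₁ refl)) ,
    ⟦⟧-~ (z<s , <⇒≤ k+3≤n) (m<n⇒m<1+n (n<1+n _) , k+4≤n) (inj₂ (inj₂ (inj₁ (refl , tt))))
  hub-adjacent-to-ThreeCommon zero _ | no 4≰n = ⊥-elim (4≰n (s≤s (s≤s (s≤s (s≤s z≤n)))))
  hub-adjacent-to-ThreeCommon (suc k) k+4≤n | no _ =
    ⟦ 0 , suc (suc k) ⟧ , ⟦ suc k , suc (suc (suc k)) ⟧ , hub-rim-ThreeCommon k (<⇒≤ k+4≤n) ,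
    ⟦⟧-~ (z<s , <⇒≤ k+4≤n) (z<s , <⇒≤ (<⇒≤ k+4≤n)) (inj₁ (refl , inj₂ refl)) ,
    ⟦⟧-~ (z<s , <⇒≤ k+4≤n) (m<n⇒m<1+n (n<1+n _) , <⇒≤ k+4≤n) (inj₂ (inj₂ (inj₂ (refl , tt))))

  hub-Spoke : ∀ k → suc (suc (suc k)) ≤ n → Spoke ⟦ 0 , suc (suc k) ⟧
  hub-Spoke k k+3≤n = (_ , hub-rim-ThreeCommon k k+3≤n) , hub-adjacent-to-ThreeCommon k k+3≤n

  hub-index : TokenAut → ℕ → ℕ
  hub-index φ i = proj₂ ⌊ to φ ⟦ 0 , i ⟧ ⌋

  InnerHub : ℕ → Set
  InnerHub i = i ∈[ 2 , pred n ]

  inner-valid : ∀ {i} → InnerHub i → Valid 0 i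
  inner-valid (2≤i , i≤n-1) = <-≤-trans z<s 2≤i , ≤-trans i≤n-1 (n≤1+n _)

  to-hub : (φ : TokenAut) → ∀ {i} → InnerHub i →
    InnerHub (hub-index φ i) × ⌊ to φ ⟦ 0 , i ⟧ ⌋ ≡ (0 , hub-index φ i)
  to-hub φ {suc (suc k)} (s≤s (s≤s z≤n) , i≤n-1) with Spoke⇒hub-pair (to-Spoke φ (hub-Spoke k (s≤s i≤n-1)))
  ... | k′ , e , k′+3≤n =
    subst (λ c → InnerHub (proj₂ c) × c ≡ (0 , proj₂ c)) (sym e) ((s≤s (s≤s z≤n) , ≤-pred k′+3≤n) , refl)

  to-hub-⟦⟧ : (φ : TokenAut) → ∀ {i} → InnerHub i → to φ ⟦ 0 , i ⟧ ≡ ⟦ 0 , hub-index φ i ⟧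
  to-hub-⟦⟧ φ i∈ = ⌊⌋⇒⟦⟧ (inner-valid (proj₁ (to-hub φ i∈))) (proj₂ (to-hub φ i∈))

  hub-pairs-consecutive : ∀ {a b} → 0 < a → 0 < b → TokenAdj (0 , a) (0 , b) → Consecutive a b
  hub-pairs-consecutive 0<a 0<b (inj₁ (refl , a~b)) = fanAdjℕ⇒consecutive 0<a 0<b a~b
  hub-pairs-consecutive _ z<s (inj₂ (inj₁ (() , _)))
  hub-pairs-consecutive z<s _ (inj₂ (inj₂ (inj₁ (() , _))))
  hub-pairs-consecutive _ _ (inj₂ (inj₂ (inj₂ (_ , ()))))

  hub-index-consecutive : (φ : TokenAut) → ∀ {i} → 2 ≤ i → suc i ≤ pred n →
    Consecutive (hub-index φ i) (hub-index φ (suc i))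
  hub-index-consecutive φ {i} 2≤i i+1≤n-1 with to-hub φ (2≤i , <⇒≤ i+1≤n-1) | to-hub φ (≤-trans 2≤i (n≤1+n i) , i+1≤n-1)
  ... | (2≤a , _) , eᵢ | (2≤b , _) , eᵢ₊₁ =
    hub-pairs-consecutive (<-≤-trans z<s 2≤a) (<-≤-trans z<s 2≤b)
      (subst₂ TokenAdj eᵢ eᵢ₊₁ (to-~ φ (⟦⟧-~ (<-≤-trans z<s 2≤i , i≤n) (z<s , i+1≤n) (inj₁ (refl , i~i+1 2≤i)))))
    where
    i+1≤n = ≤-trans i+1≤n-1 (n≤1+n _)
    i≤n = <⇒≤ i+1≤n
    i~i+1 : ∀ {j} → 2 ≤ j → FanAdjℕ j (suc j)
    i~i+1 (s≤s _) = inj₁ refl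

  hub-index-inverse : (φ : TokenAut) → ∀ {i} → InnerHub i → hub-index (φ ⁻¹) (hub-index φ i) ≡ i
  hub-index-inverse φ {i} i∈ = begin
    proj₂ ⌊ from φ ⟦ 0 , hub-index φ i ⟧ ⌋ ≡⟨ cong (λ X → proj₂ ⌊ from φ X ⌋) (to-hub-⟦⟧ φ i∈) ⟨
    proj₂ ⌊ from φ (to φ ⟦ 0 , i ⟧) ⌋      ≡⟨ cong (λ X → proj₂ ⌊ X ⌋) (from-to φ ⟦ 0 , i ⟧) ⟩
    proj₂ ⌊ ⟦ 0 , i ⟧ ⌋                    ≡⟨ cong proj₂ (⌊⟦⟧⌋ (inner-valid i∈)) ⟩
    i                                      ∎
    where open ≡-Reasoning

  ∈₂⇔toℕ : ∀ X z → z ∈₂ X ⇔ (toℕ z ≡ proj₁ ⌊ X ⌋ ⊎ toℕ z ≡ proj₂ ⌊ X ⌋)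
  ∈₂⇔toℕ X z = mk⇔ (⊎-map (cong toℕ) (cong toℕ)) (⊎-map toℕ-injective toℕ-injective)

  ∈⟦⟧ : ∀ {a b} → Valid a b → ∀ z → z ∈₂ ⟦ a , b ⟧ ⇔ (toℕ z ≡ a ⊎ toℕ z ≡ b)
  ∈⟦⟧ {a} {b} ab z =
    subst (λ c → z ∈₂ ⟦ a , b ⟧ ⇔ (toℕ z ≡ proj₁ c ⊎ toℕ z ≡ proj₂ c)) (⌊⟦⟧⌋ ab) (∈₂⇔toℕ ⟦ a , b ⟧ z)

  reflectᵗ : TokenAut
  reflectᵗ = fromAut (liftAut {suc n} {FanAdj} reflectAut)

  reflect-hub : ∀ {i j} → Valid 0 i → Valid 0 j → j + i ≡ suc n → to reflectᵗ ⟦ 0 , i ⟧ ≡ ⟦ 0 , j ⟧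
  reflect-hub {i} {j} 0i 0j j+i≡ = ⊆⇒≡ λ z z∈ →
    Equivalence.from (∈⟦⟧ 0j z)
      (toℕ-reflect z (Equivalence.to (∈⟦⟧ 0i (reflect z))
        (Equivalence.to (∈-liftAut⇔ {suc n} {FanAdj} reflectAut ⟦ 0 , i ⟧ z) z∈)))
    where
    open ≡-Reasoning
    toℕ-reflect : ∀ z → toℕ (reflect z) ≡ 0 ⊎ toℕ (reflect z) ≡ i → toℕ z ≡ 0 ⊎ toℕ z ≡ j
    toℕ-reflect zero _ = inj₁ refl
    toℕ-reflect (suc w) (inj₂ e) = inj₂ (+-cancelˡ-≡ i _ _ (begin
      i + suc (toℕ w)                  ≡⟨ cong (_+ suc (toℕ w)) e ⟨
      suc (toℕ (opposite w) + suc (toℕ w)) ≡⟨ cong suc (opposite-sum w) ⟩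
      suc n                            ≡⟨ j+i≡ ⟨
      j + i                            ≡⟨ +-comm j i ⟩
      i + j                            ∎))

  Fixes : TokenAut → Set
  Fixes φ = ∀ {i} → InnerHub i → to φ ⟦ 0 , i ⟧ ≡ ⟦ 0 , i ⟧

  same-image : (φ : TokenAut) → ∀ {X Y Z} → to φ X ≡ Z → to φ Y ≡ Z → X ≡ Y
  same-image φ eX eY = to-injective φ (trans eX (sym eY))

  image-adjacent : (φ : TokenAut) → ∀ {X Y a b} → Valid a b → X ~ Y → to φ Y ≡ ⟦ a , b ⟧ → TokenAdj ⌊ to φ X ⌋ (a , b)
  image-adjacent φ {X} ab X~Y φY = subst (TokenAdj ⌊ to φ X ⌋) (⌊⟦⟧⌋ ab) (subst (to φ X ~_) φY (to-~ φ X~Y))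

  -- The common neighbours of {v,u₂} and {u₁,u₃} are {v,u₁}, {v,u₃}, {u₁,u₂}, {u₂,u₃}; φ fixes the
  -- second and the fourth, and cannot swap the others, since {v,u₁} has degree n and {u₁,u₂} degree 3.
  module _ (φ : TokenAut) (fixes : Fixes φ) where

    private
      v01 = valid 0 1
      v02 = valid 0 2
      v03 = valid 0 3
      v12 = valid 1 2
      v13 = valid 1 3
      v14 = valid 1 4
      v23 = valid 2 3

      fixes-⟦0,2⟧ : to φ ⟦ 0 , 2 ⟧ ≡ ⟦ 0 , 2 ⟧
      fixes-⟦0,2⟧ = fixes (≤-refl , s≤s (s≤s z≤n))

      fixes-⟦0,3⟧ : to φ ⟦ 0 , 3 ⟧ ≡ ⟦ 0 , 3 ⟧
      fixes-⟦0,3⟧ = fixes (s≤s (s≤s z≤n) , s≤s (s≤s (s≤s z≤n)))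

      fixes-⟦1,3⟧ : to φ ⟦ 1 , 3 ⟧ ≡ ⟦ 1 , 3 ⟧
      fixes-⟦1,3⟧ = partner (ThreeCommon⇒straddle (subst (λ X → ThreeCommon X (to φ ⟦ 1 , 3 ⟧)) fixes-⟦0,2⟧
                                                          (to-ThreeCommon φ (hub-rim-ThreeCommon 0 (proj₂ v13)))))
        where
        partner : Straddle ⌊ ⟦ 0 , 2 ⟧ ⌋ ⌊ to φ ⟦ 1 , 3 ⟧ ⌋ ⊎ Straddle ⌊ to φ ⟦ 1 , 3 ⟧ ⌋ ⌊ ⟦ 0 , 2 ⟧ ⌋ →
          to φ ⟦ 1 , 3 ⟧ ≡ ⟦ 1 , 3 ⟧
        partner (inj₁ (_ , e₀₂ , e)) with trans (sym (⌊⟦⟧⌋ v02)) e₀₂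
        ... | refl = ⌊⌋⇒⟦⟧ v13 e
        partner (inj₂ (_ , _ , e₀₂)) with trans (sym (⌊⟦⟧⌋ v02)) e₀₂
        ... | ()

      fixes-⟦2,3⟧ : to φ ⟦ 2 , 3 ⟧ ≡ ⟦ 2 , 3 ⟧
      fixes-⟦2,3⟧ = ⌊⌋⇒⟦⟧ v23 (common-neighbour-02-03 (⌊⌋-ordered (to φ ⟦ 2 , 3 ⟧))
        (image-adjacent φ v02 (⟦⟧-~ v23 v02 (inj₂ (inj₁ (refl , tt)))) fixes-⟦0,2⟧)
        (image-adjacent φ v03 (⟦⟧-~ v23 v03 (inj₂ (inj₂ (inj₂ (refl , tt))))) fixes-⟦0,3⟧))

      Candidate : Pair → Set
      Candidate Y = Y ≡ ⟦ 2 , 3 ⟧ ⊎ Y ≡ ⟦ 1 , 2 ⟧ ⊎ Y ≡ ⟦ 0 , 3 ⟧ ⊎ Y ≡ ⟦ 0 , 1 ⟧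

      candidate : ∀ {X} → X ~ ⟦ 0 , 2 ⟧ → X ~ ⟦ 1 , 3 ⟧ → Candidate (to φ X)
      candidate {X} X~02 X~13 =
        ⊎-map (⌊⌋⇒⟦⟧ v23) (⊎-map (⌊⌋⇒⟦⟧ v12) (⊎-map (⌊⌋⇒⟦⟧ v03) (⌊⌋⇒⟦⟧ v01)))
          (common-neighbour-02-13 (⌊⌋-ordered (to φ X))
            (image-adjacent φ v02 X~02 fixes-⟦0,2⟧) (image-adjacent φ v13 X~13 fixes-⟦1,3⟧))

      not-swapped : to φ ⟦ 0 , 1 ⟧ ≡ ⟦ 1 , 2 ⟧ → ⊥
      not-swapped φ01 = image-of-⟦1,2⟧
        (candidate (⟦⟧-~ v12 v02 (inj₂ (inj₂ (inj₂ (refl , tt))))) (⟦⟧-~ v12 v13 (inj₁ (refl , inj₁ refl))))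
        where
        image-of-⟦1,4⟧ : to φ ⟦ 1 , 2 ⟧ ≡ ⟦ 0 , 1 ⟧ →
          ⌊ to φ ⟦ 1 , 4 ⟧ ⌋ ≡ (0 , 1) ⊎ ⌊ to φ ⟦ 1 , 4 ⟧ ⌋ ≡ (0 , 2) ⊎ ⌊ to φ ⟦ 1 , 4 ⟧ ⌋ ≡ (1 , 3) → ⊥
        image-of-⟦1,4⟧ φ12 (inj₁ e) = ⟦⟧-≢ v14 v12 (λ ()) (same-image φ (⌊⌋⇒⟦⟧ v01 e) φ12)
        image-of-⟦1,4⟧ _ (inj₂ (inj₁ e)) = ⟦⟧-≢ v14 v02 (λ ()) (same-image φ (⌊⌋⇒⟦⟧ v02 e) fixes-⟦0,2⟧)
        image-of-⟦1,4⟧ _ (inj₂ (inj₂ e)) = ⟦⟧-≢ v14 v13 (λ ()) (same-image φ (⌊⌋⇒⟦⟧ v13 e) fixes-⟦1,3⟧)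
        image-of-⟦1,2⟧ : Candidate (to φ ⟦ 1 , 2 ⟧) → ⊥
        image-of-⟦1,2⟧ (inj₁ e) = ⟦⟧-≢ v12 v23 (λ ()) (same-image φ e fixes-⟦2,3⟧)
        image-of-⟦1,2⟧ (inj₂ (inj₁ e)) = ⟦⟧-≢ v12 v01 (λ ()) (same-image φ e φ01)
        image-of-⟦1,2⟧ (inj₂ (inj₂ (inj₁ e))) = ⟦⟧-≢ v12 v03 (λ ()) (same-image φ e fixes-⟦0,3⟧)
        image-of-⟦1,2⟧ (inj₂ (inj₂ (inj₂ φ12))) = image-of-⟦1,4⟧ φ12
          (neighbour-12 (⌊⌋-ordered (to φ ⟦ 1 , 4 ⟧)) (image-adjacent φ v12 (⟦⟧-~ v14 v01 (inj₂ (inj₁ (refl , tt)))) φ01))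

      image-of-⟦0,1⟧ : Candidate (to φ ⟦ 0 , 1 ⟧) → to φ ⟦ 0 , 1 ⟧ ≡ ⟦ 0 , 1 ⟧
      image-of-⟦0,1⟧ (inj₁ e) = ⊥-elim (⟦⟧-≢ v01 v23 (λ ()) (same-image φ e fixes-⟦2,3⟧))
      image-of-⟦0,1⟧ (inj₂ (inj₁ e)) = ⊥-elim (not-swapped e)
      image-of-⟦0,1⟧ (inj₂ (inj₂ (inj₁ e))) = ⊥-elim (⟦⟧-≢ v01 v03 (λ ()) (same-image φ e fixes-⟦0,3⟧))
      image-of-⟦0,1⟧ (inj₂ (inj₂ (inj₂ e))) = e

    fixes-⟦0,1⟧ : to φ ⟦ 0 , 1 ⟧ ≡ ⟦ 0 , 1 ⟧
    fixes-⟦0,1⟧ = image-of-⟦0,1⟧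
      (candidate (⟦⟧-~ v01 v02 (inj₁ (refl , inj₁ refl))) (⟦⟧-~ v01 v13 (inj₂ (inj₂ (inj₁ (refl , tt))))))

  mirror-inner : ∀ {i} → InnerHub i → Σ ℕ λ j → InnerHub j × j + i ≡ suc n
  mirror-inner {suc (suc i)} (s≤s (s≤s _) , i+2≤n-1) =
    pred n ∸ i , (2≤n-1-i , m∸n≤m (pred n) i) , (begin
      pred n ∸ i + suc (suc i)   ≡⟨ +-suc _ (suc i) ⟩
      suc (pred n ∸ i + suc i)   ≡⟨ cong suc (+-suc _ i) ⟩
      suc (suc (pred n ∸ i + i)) ≡⟨ cong (2 +_) (m∸n+n≡m (<⇒≤ (<⇒≤ i+2≤n-1))) ⟩
      suc n                      ∎)
    where
    open ≡-Reasoning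
    2≤n-1-i : 2 ≤ pred n ∸ i
    2≤n-1-i = subst (_≤ pred n ∸ i) (m+n∸n≡m 2 i) (∸-monoˡ-≤ i i+2≤n-1)

  reflectᵗ-involutive : ∀ X → to reflectᵗ (to reflectᵗ X) ≡ X
  reflectᵗ-involutive X = ⊆⇒≡ λ z z∈ →
    subst (_∈₂ X) (reflect-involutive z)
      (Equivalence.to (∈-liftAut⇔ {suc n} {FanAdj} reflectAut X (reflect z))
        (Equivalence.to (∈-liftAut⇔ {suc n} {FanAdj} reflectAut (to reflectᵗ X) z) z∈))

  reflect-conjugate-Fixes : (φ : TokenAut) → Fixes φ → Fixes (reflectᵗ ∘ᵗ (φ ∘ᵗ reflectᵗ))
  reflect-conjugate-Fixes φ fixes {i} i∈ with mirror-inner i∈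
  ... | j , j∈ , j+i = begin
    to reflectᵗ (to φ (to reflectᵗ ⟦ 0 , i ⟧))
      ≡⟨ cong (to reflectᵗ ∘ to φ) (reflect-hub (inner-valid i∈) (inner-valid j∈) j+i) ⟩
    to reflectᵗ (to φ ⟦ 0 , j ⟧)               ≡⟨ cong (to reflectᵗ) (fixes j∈) ⟩
    to reflectᵗ ⟦ 0 , j ⟧                      ≡⟨ reflect-hub (inner-valid j∈) (inner-valid i∈) (trans (+-comm i j) j+i) ⟩
    ⟦ 0 , i ⟧                                  ∎
    where open ≡-Reasoning

  fixes-⟦0,n⟧ : (φ : TokenAut) → Fixes φ → to φ ⟦ 0 , n ⟧ ≡ ⟦ 0 , n ⟧
  fixes-⟦0,n⟧ φ fixes = begin
    to φ ⟦ 0 , n ⟧                                                 ≡⟨ cong (to φ) ρ⟦0,1⟧ ⟨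
    to φ (to reflectᵗ ⟦ 0 , 1 ⟧)                                   ≡⟨ reflectᵗ-involutive _ ⟨
    to reflectᵗ (to reflectᵗ (to φ (to reflectᵗ ⟦ 0 , 1 ⟧)))
      ≡⟨ cong (to reflectᵗ) (fixes-⟦0,1⟧ (reflectᵗ ∘ᵗ (φ ∘ᵗ reflectᵗ)) (reflect-conjugate-Fixes φ fixes)) ⟩
    to reflectᵗ ⟦ 0 , 1 ⟧                                          ≡⟨ ρ⟦0,1⟧ ⟩
    ⟦ 0 , n ⟧                                                      ∎
    where
    open ≡-Reasoning
    ρ⟦0,1⟧ : to reflectᵗ ⟦ 0 , 1 ⟧ ≡ ⟦ 0 , n ⟧
    ρ⟦0,1⟧ = reflect-hub (valid 0 1) (z<s , ≤-refl) (+-comm n 1)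

  fixes-hubs : (φ : TokenAut) → Fixes φ → ∀ {i} → Valid 0 i → to φ ⟦ 0 , i ⟧ ≡ ⟦ 0 , i ⟧
  fixes-hubs φ fixes {i} (0<i , i≤n) with i ≟ 1 | i ≟ n
  ... | yes refl | _ = fixes-⟦0,1⟧ φ fixes
  ... | no _ | yes refl = fixes-⟦0,n⟧ φ fixes
  ... | no i≢1 | no i≢n = fixes (≤∧≢⇒< 0<i (λ e → i≢1 (sym e)) , ≤-pred (≤∧≢⇒< i≤n i≢n))

  fixes-rims : (φ : TokenAut) → Fixes φ → ∀ {a b} → 0 < a → Valid a b → to φ ⟦ a , b ⟧ ≡ ⟦ a , b ⟧
  fixes-rims φ fixes {suc a} {suc b} _ ab@(a<b , b≤n)
    with common-neighbour-shared {C = ⌊ to φ ⟦ suc a , suc b ⟧ ⌋} {0} z<s z<s (⌊⌋-ordered (to φ ⟦ suc a , suc b ⟧))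
           (inj₁ refl) (inj₁ refl) (λ e → <-irrefl e a<b)
           (image-adjacent φ 0a (⟦⟧-~ ab 0a (inj₂ (inj₁ (refl , tt)))) (fixes-hubs φ fixes 0a))
           (image-adjacent φ 0b (⟦⟧-~ ab 0b (inj₂ (inj₂ (inj₂ (refl , tt))))) (fixes-hubs φ fixes 0b))
    where
    0a = z<s , ≤-trans (<⇒≤ a<b) b≤n
    0b = z<s , b≤n
  ... | inj₂ (C≈ , _) = ⌊⌋⇒⟦⟧ ab (≈-ordered (⌊⌋-ordered (to φ ⟦ suc a , suc b ⟧)) C≈ a<b)
  ... | inj₁ (u , C≈ , _) = ⊥-elim (⟦⟧-≢ ab 0u (λ ()) (same-image φ φab (fixes-hubs φ fixes 0u)))
    where
    0<u : 0 < u
    0<u = ≤∧≢⇒< z≤n (≈-distinct (⌊⌋-ordered (to φ ⟦ suc a , suc b ⟧)) C≈)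
    C≡ : ⌊ to φ ⟦ suc a , suc b ⟧ ⌋ ≡ (0 , u)
    C≡ = ≈-ordered (⌊⌋-ordered (to φ ⟦ suc a , suc b ⟧)) C≈ 0<u
    0u : Valid 0 u
    0u = 0<u , subst (λ c → proj₂ c ≤ n) C≡ (⌊⌋-bounded (to φ ⟦ suc a , suc b ⟧))
    φab : to φ ⟦ suc a , suc b ⟧ ≡ ⟦ 0 , u ⟧
    φab = ⌊⌋⇒⟦⟧ 0u C≡

  Fixes⇒identity : (φ : TokenAut) → Fixes φ → ∀ X → to φ X ≡ X
  Fixes⇒identity φ fixes X = subst (λ Y → to φ Y ≡ Y) (sym (⌊⌋⇒⟦⟧ X-valid refl)) (fixes-valid X-valid)
    where
    X-valid : Valid (proj₁ ⌊ X ⌋) (proj₂ ⌊ X ⌋)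
    X-valid = ⌊⌋-ordered X , ⌊⌋-bounded X
    fixes-valid : ∀ {a b} → Valid a b → to φ ⟦ a , b ⟧ ≡ ⟦ a , b ⟧
    fixes-valid {zero} = fixes-hubs φ fixes
    fixes-valid {suc a} = fixes-rims φ fixes z<s

  hub-index-rigid : (φ : TokenAut) →
    (∀ {i} → InnerHub i → hub-index φ i ≡ i) ⊎ (∀ {i} → InnerHub i → hub-index φ i + i ≡ suc n)
  hub-index-rigid φ = IntervalRigidity.identity-or-reflection 2 (pred n) (s≤s (s≤s (s≤s z≤n)))
    (hub-index φ) (hub-index (φ ⁻¹)) (λ i∈ → proj₁ (to-hub φ i∈)) (λ i∈ → proj₁ (to-hub (φ ⁻¹) i∈))
    (hub-index-inverse φ) (hub-index-inverse (φ ⁻¹)) (hub-index-consecutive φ) (hub-index-consecutive (φ ⁻¹))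

  identity-or-reflection : (φ : TokenAut) → (∀ X → to φ X ≡ X) ⊎ (∀ X → to φ X ≡ to reflectᵗ X)
  identity-or-reflection φ with hub-index-rigid φ
  ... | inj₁ identity = inj₁ (Fixes⇒identity φ λ i∈ → trans (to-hub-⟦⟧ φ i∈) (cong (λ j → ⟦ 0 , j ⟧) (identity i∈)))
  ... | inj₂ reflection = inj₂ λ X →
    trans (sym (reflectᵗ-involutive (to φ X))) (cong (to reflectᵗ) (Fixes⇒identity (reflectᵗ ∘ᵗ φ) reflected-Fixes X))
    where
    reflected-Fixes : Fixes (reflectᵗ ∘ᵗ φ)
    reflected-Fixes {i} i∈ = trans (cong (to reflectᵗ) (to-hub-⟦⟧ φ i∈))
      (reflect-hub (inner-valid (proj₁ (to-hub φ i∈))) (inner-valid i∈) (trans (+-comm i (hub-index φ i)) (reflection i∈)))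

  induced : (φ : Aut (F2Fan n)) → Σ (Aut (Fan n)) (InducedBy n φ)
  induced φ with identity-or-reflection (fromAut φ)
  ... | inj₁ φ≗id = idAut , InducedBy-liftAut φ idAut λ A → trans (φ≗id A) (sym (liftAut-id {suc n} {FanAdj} A))
  ... | inj₂ φ≗ρ = reflectAut , InducedBy-liftAut φ reflectAut φ≗ρ

mainTheorem9 : (n : ℕ) → 4 ≤ n →
    ((φ : Aut (F2Fan n)) → Σ (Aut (Fan n)) (λ θ → InducedBy n φ θ))
    × HasOrderTwo (Fan n)
mainTheorem9 .(4 + m) (s≤s (s≤s (s≤s (s≤s (z≤n {m}))))) = TokenGraph.induced m , Aut-has-order-two
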